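{- Let $n,k,k'$ be integers with $n\geq k\geq 2$ and $k\geq k'\geq 1$. (1) $Sr_{k,k'}(K_n)=k-1$. (2) For the path $P_n$ on $n$ vertices: $Sr_{k,k'}(P_n)=k-1$ if $k-k'=0$; $Sr_{k,k'}(P_n)=\left\lceil \frac{n+k'-2}{2}\right\rceil$ if $k-k'=1$; and $Sr_{k,k'}(P_n)=n-1$ if $k-k'\geq 2$. (3) For a complete $r$-partite graph $K_{n_1,n_2,\ldots,n_r}$ of order $n$ with part sizes $n_1\leq n_2\leq\cdots\leq n_r$: if $k'=1$, then $Sr_{k,k'}(K_{n_1,\ldots,n_r})=k$ when $n_1\geq k$ and $Sr_{k,k'}(K_{n_1,\ldots,n_r})=k-1$ when $n_1\leq k-1$; if $k'\geq 2$, then $Sr_{k,k'}(K_{n_1,\ldots,n_r})=k-1$.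
   Context: All graphs are finite, simple and connected. For a graph $G$ and $S\subseteq V(G)$, the Steiner distance $d_G(S)$ is the minimum number of edges of a connected subgraph of $G$ (equivalently, of a subtree of $G$) whose vertex set contains $S$. For integers $k\geq 2$, $1\leq k'\leq k$, $|V(G)|\geq k$, and a $k'$-subset $S'\subseteq V(G)$, the Steiner $(k,k')$-eccentricity of $S'$ is $\varepsilon_{k,k'}(S';G)=\max\{d_G(S): S'\subseteq S\subseteq V(G),\ |S|=k\}$, and the Steiner $(k,k')$-radius is $Sr_{k,k'}(G)=\min\{\varepsilon_{k,k'}(S';G): S'\subseteq V(G),\ |S'|=k'\}$. -}

module Defs where

open import Data.Nat using (ℕ; zero; suc; _+_; _≤_; _<ᵇ_; _≡ᵇ_)
open import Data.Bool using (Bool; true; false; not; _∧_; _∨_; if_then_else_)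
open import Data.Fin using (Fin; toℕ; _≟_)
open import Data.Fin.Subset using (Subset; _∈_; _⊆_; ∣_∣)
open import Data.List using (List; map; allFin)
open import Data.Nat.ListAction using (sum)
open import Data.Vec using (tabulate)
open import Data.Product using (Σ; ∃; _×_)
open import Relation.Nullary using (does)
open import Relation.Binary.PropositionalEquality using (_≡_)

record Graph (n : ℕ) : Set where
  field
    adj    : Fin n → Fin n → Bool
    sym    : ∀ u v → adj u v ≡ adj v u
    irrefl : ∀ u → adj u u ≡ false
open Graph public

data Walk {n : ℕ} (F : Fin n → Fin n → Bool) : Fin n → Fin n → Set where
  here : ∀ {u} → Walk F u u
  step : ∀ {u w v} → F u w ≡ true → Walk F w v → Walk F u v

edgeCount : {n : ℕ} → (Fin n → Fin n → Bool) → ℕ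
edgeCount {n} F =
  sum (map (λ i → sum (map (λ j → if (toℕ i <ᵇ toℕ j) ∧ F i j then 1 else 0)
                             (allFin n)))
           (allFin n))

record Subgraph {n : ℕ} (G : Graph n) : Set where
  field
    verts    : Subset n
    edges    : Fin n → Fin n → Bool
    e-sym    : ∀ u v → edges u v ≡ edges v u
    e-in-G   : ∀ u v → edges u v ≡ true → adj G u v ≡ true
    e-in-W   : ∀ u v → edges u v ≡ true → u ∈ verts
open Subgraph public

ConnectedSub : {n : ℕ} {G : Graph n} → Subgraph G → Set
ConnectedSub H = ∀ u v → u ∈ verts H → v ∈ verts H → Walk (edges H) u v

HasSteinerSubgraph : {n : ℕ} → Graph n → Subset n → ℕ → Set
HasSteinerSubgraph G S m =
  Σ (Subgraph G) λ H → ConnectedSub H × S ⊆ verts H × edgeCount (edges H) ≡ m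

SteinerDist : {n : ℕ} → Graph n → Subset n → ℕ → Set
SteinerDist G S d =
  HasSteinerSubgraph G S d × (∀ m → HasSteinerSubgraph G S m → d ≤ m)

SteinerEcc : {n : ℕ} → Graph n → ℕ → Subset n → ℕ → Set
SteinerEcc G k S' e =
  (∃ λ S → S' ⊆ S × ∣ S ∣ ≡ k × SteinerDist G S e)
  × (∀ S d → S' ⊆ S → ∣ S ∣ ≡ k → SteinerDist G S d → d ≤ e)

SteinerRad : {n : ℕ} → Graph n → ℕ → ℕ → ℕ → Set
SteinerRad G k k' r =
  (∃ λ S' → ∣ S' ∣ ≡ k' × SteinerEcc G k S' r)
  × (∀ S' e → ∣ S' ∣ ≡ k' → SteinerEcc G k S' e → r ≤ e)

complete : (n : ℕ) → Graph n
complete n = record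
  { adj = λ u v → not (toℕ u ≡ᵇ toℕ v)
  ; sym = symK
  ; irrefl = irrK }
  where
    open import Data.Nat.Properties using (≡ᵇ⇒≡; ≡⇒≡ᵇ)
    open import Relation.Binary.PropositionalEquality using (refl; cong; sym)
    symℕ : ∀ a b → (a ≡ᵇ b) ≡ (b ≡ᵇ a)
    symℕ zero zero = refl
    symℕ zero (suc b) = refl
    symℕ (suc a) zero = refl
    symℕ (suc a) (suc b) = symℕ a b
    symK : ∀ (u v : Fin n) → not (toℕ u ≡ᵇ toℕ v) ≡ not (toℕ v ≡ᵇ toℕ u)
    symK u v = cong not (symℕ (toℕ u) (toℕ v))
    reflℕ : ∀ a → (a ≡ᵇ a) ≡ true
    reflℕ zero = refl
    reflℕ (suc a) = reflℕ a
    irrK : ∀ (u : Fin n) → not (toℕ u ≡ᵇ toℕ u) ≡ false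
    irrK u = cong not (reflℕ (toℕ u))

path : (n : ℕ) → Graph n
path n = record
  { adj = λ u v → (suc (toℕ u) ≡ᵇ toℕ v) ∨ (suc (toℕ v) ≡ᵇ toℕ u)
  ; sym = λ u v → ∨-comm (suc (toℕ u) ≡ᵇ toℕ v) (suc (toℕ v) ≡ᵇ toℕ u)
  ; irrefl = λ u → cong₂ _∨_ (sne (toℕ u)) (sne (toℕ u)) }
  where
    open import Data.Bool.Properties using (∨-comm)
    open import Relation.Binary.PropositionalEquality using (refl; cong₂)
    sne : ∀ a → (suc a ≡ᵇ a) ≡ false
    sne zero = refl
    sne (suc a) = sne a

multipartite : {n r : ℕ} → (Fin n → Fin r) → Graph n
multipartite {n} part = record
  { adj = λ u v → not (does (part u ≟ part v))
  ; sym = λ u v → cong not (symD (part u) (part v))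
  ; irrefl = λ u → cong not (reflD (part u)) }
  where
    open import Relation.Binary.PropositionalEquality using (refl; cong)
    open import Relation.Nullary using (yes; no)
    import Relation.Binary.PropositionalEquality as P
    symD : ∀ {r} (a b : Fin r) → does (a ≟ b) ≡ does (b ≟ a)
    symD a b with a ≟ b | b ≟ a
    ... | yes _ | yes _ = refl
    ... | no _  | no _  = refl
    ... | yes p | no q  = Data.Empty.⊥-elim (q (P.sym p))
      where import Data.Empty
    ... | no q  | yes p = Data.Empty.⊥-elim (q (P.sym p))
      where import Data.Empty
    reflD : ∀ {r} (a : Fin r) → does (a ≟ a) ≡ true
    reflD a with a ≟ a
    ... | yes _ = refl
    ... | no q  = Data.Empty.⊥-elim (q refl)
      where import Data.Empty

partSize : {n r : ℕ} → (Fin n → Fin r) → Fin r → ℕ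
partSize part p = ∣ tabulate (λ i → does (part i ≟ p)) ∣

module Submission where

-- Lower bounds: a connected subgraph on V vertices has at least V − 1 edges (grow a subtree
-- from one vertex, one crossing edge at a time), so d(S) ≥ |S| − 1.  In P_n a connected
-- subgraph containing u ≤ v contains every vertex in between, so d(S) = max S − min S; in a
-- complete multipartite graph a connected subgraph containing two vertices of one part also
-- contains a vertex of another part.  Upper bounds come from trees given by parent pointers,
-- which have at most one edge per non-root vertex: stars in K_n, double stars in the
-- multipartite graph, subpaths in P_n.  Each radius is then witnessed either by a k′-set all
-- of whose k-supersets meet the lower bound k − 1, or by an upper bound valid for all k-sets
-- that every k′-set extends to a k-set attaining.  For P_n with k = k′ + 1 the central k′-set
-- is a block of consecutive vertices whose distances to the two ends are balanced.

open import Defs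
open import Data.Nat using (ℕ; suc; _+_; _∸_; _≤_; _<_; ⌈_/2⌉)
open import Data.Fin using (Fin; zero) renaming (_≤_ to _≤ᶠ_)
open import Data.Product using (_×_)
open import Relation.Binary.PropositionalEquality using (_≡_)

open import Data.Bool using (Bool; true; false; not; _∧_; _∨_; if_then_else_)
open import Data.Bool.Properties using (T-≡; ∧-comm; ∨-comm; ∨-zeroʳ)
open import Data.Fin using (toℕ; fromℕ; fromℕ<; pred; suc; _≟_)
open import Data.Fin.Properties using (toℕ-injective; toℕ-fromℕ<; toℕ-fromℕ; toℕ<n; toℕ-inject₁; any?)
import Data.Fin.Properties as Fin
open import Data.Fin.Subset
  using (Subset; inside; outside; _∈_; _∉_; _⊆_; ∣_∣; ⁅_⁆; _∪_; _─_; _-_; ⊤; ⊥; Nonempty)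
open import Data.Fin.Subset.Properties
import Data.List as List
import Data.List.Properties as List
open import Data.Nat using (zero; z≤n; s≤s; s≤s⁻¹; s<s⁻¹; _<ᵇ_; _≡ᵇ_; _≤?_; _<?_; ⌊_/2⌋)
open import Data.Nat.ListAction using () renaming (sum to sumˡ)
open import Data.Nat.Properties hiding (_≟_)
open import Algebra.Properties.CommutativeMonoid.Sum +-0-commutativeMonoid
  using (sum; sum-syntax; ∑-distrib-+; ∑-comm; sum-cong-≗)
open import Data.Product using (∃; ∃₂; _,_; proj₁; proj₂)
open import Data.Sum using (_⊎_; inj₁; inj₂)
open import Data.Vec using (_∷_; []; tabulate; here; there)
open import Data.Vec.Properties using (lookup∘tabulate; []=⇒lookup; lookup⇒[]=)
open import Function using (_∘_; id; Equivalence)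
open import Relation.Binary.Definitions using (tri<; tri≈; tri>)
import Relation.Binary.PropositionalEquality as ≡
open import Relation.Binary.PropositionalEquality
  using (refl; trans; cong; cong₂; subst; subst₂; _≢_; module ≡-Reasoning)
open import Relation.Nullary using (Dec; yes; no; does; contradiction)
open import Relation.Nullary.Decidable using (dec-true; dec-false; _×-dec_; _⊎-dec_; ¬?)

private variable
  n k : ℕ

𝟙 : Bool → ℕ
𝟙 b = if b then 1 else 0

𝟙-mono : ∀ {a b : Bool} → (a ≡ true → b ≡ true) → 𝟙 a ≤ 𝟙 b
𝟙-mono {false} _   = z≤n
𝟙-mono {true}  a⇒b rewrite a⇒b refl = ≤-refl

∧-monoʳ : ∀ {a b c} → (b ≡ true → c ≡ true) → a ∧ b ≡ true → a ∧ c ≡ true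
∧-monoʳ {true} b⇒c = b⇒c

∧-true⁻ : ∀ {a b} → a ∧ b ≡ true → a ≡ true × b ≡ true
∧-true⁻ {true} b≡true = refl , b≡true

∨-true⁻ : ∀ {a b} → a ∨ b ≡ true → a ≡ true ⊎ b ≡ true
∨-true⁻ {true}  _      = inj₁ refl
∨-true⁻ {false} b≡true = inj₂ b≡true

does⁻ : ∀ {A : Set} (a? : Dec A) → does a? ≡ true → A
does⁻ (yes a) _ = a

𝟙-∧-∨ : ∀ a b c → 𝟙 (a ∧ (b ∨ c)) ≤ 𝟙 (b ∧ a) + 𝟙 (c ∧ a)
𝟙-∧-∨ false b     c = z≤n
𝟙-∧-∨ true  true  c = s≤s z≤n
𝟙-∧-∨ true  false false = z≤n
𝟙-∧-∨ true  false true  = ≤-refl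

𝟙-<ᵇ-asym : ∀ a m k → 𝟙 (a ∧ (m <ᵇ k)) + 𝟙 (a ∧ (k <ᵇ m)) ≤ 𝟙 a
𝟙-<ᵇ-asym false _       _       = z≤n
𝟙-<ᵇ-asym true  zero    zero    = z≤n
𝟙-<ᵇ-asym true  zero    (suc k) = ≤-refl
𝟙-<ᵇ-asym true  (suc m) zero    = ≤-refl
𝟙-<ᵇ-asym true  (suc m) (suc k) = 𝟙-<ᵇ-asym true m k

∑-mono-≤ : ∀ {f g : Fin n → ℕ} → (∀ i → f i ≤ g i) → sum f ≤ sum g
∑-mono-≤ {zero}  f≤g = ≤-refl
∑-mono-≤ {suc n} f≤g = +-mono-≤ (f≤g zero) (∑-mono-≤ (f≤g ∘ suc))

∑-mono-< : ∀ {f g : Fin n → ℕ} (c : Fin n) → (∀ i → f i ≤ g i) → f c < g c → sum f < sum g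
∑-mono-< zero    f≤g fc<gc = +-mono-<-≤ fc<gc (∑-mono-≤ (f≤g ∘ suc))
∑-mono-< (suc c) f≤g fc<gc = +-mono-≤-< (f≤g zero) (∑-mono-< c (f≤g ∘ suc) fc<gc)

∑-zero : ∀ {f : Fin n → ℕ} → (∀ i → f i ≡ 0) → sum f ≡ 0
∑-zero {zero}  f≡0 = refl
∑-zero {suc n} f≡0 = cong₂ _+_ (f≡0 zero) (∑-zero (f≡0 ∘ suc))

∑-δ : ∀ {f : Fin n → ℕ} (c : Fin n) → (∀ i → i ≢ c → f i ≡ 0) → sum f ≡ f c
∑-δ {f = f} zero    f≡0 = trans (cong (f zero +_) (∑-zero λ i → f≡0 (suc i) λ ())) (+-identityʳ _)
∑-δ         (suc c) f≡0 = cong₂ _+_ (f≡0 zero λ ()) (∑-δ c λ i i≢c → f≡0 (suc i) (i≢c ∘ Fin.suc-injective))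

∑-𝟙-≟ : ∀ (c : Fin n) (b : Bool) (f : Fin n → Bool) →
        ∑[ i < n ] 𝟙 ((does (c ≟ i) ∧ b) ∧ f i) ≡ 𝟙 (b ∧ f c)
∑-𝟙-≟ c b f = trans
  (∑-δ c λ i i≢c → cong (λ z → 𝟙 ((z ∧ b) ∧ f i)) (dec-false (c ≟ i) (i≢c ∘ ≡.sym)))
  (cong (λ z → 𝟙 ((z ∧ b) ∧ f c)) (dec-true (c ≟ c) refl))

listSum-map-allFin : ∀ (f : Fin n → ℕ) → sumˡ (List.map f (List.allFin n)) ≡ sum f
listSum-map-allFin {n} f = trans (cong sumˡ (List.map-tabulate id f)) (go f)
  where
  go : ∀ {n} (f : Fin n → ℕ) → sumˡ (List.tabulate f) ≡ sum f
  go {zero}  f = refl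
  go {suc n} f = cong (f zero +_) (go (f ∘ suc))

∣p∣≡∑ : ∀ (p : Subset n) → ∣ p ∣ ≡ ∑[ i < n ] 𝟙 (does (i ∈? p))
∣p∣≡∑ []            = refl
∣p∣≡∑ (inside  ∷ p) = cong suc (∣p∣≡∑ p)
∣p∣≡∑ (outside ∷ p) = ∣p∣≡∑ p

x∈p─q⇒x∉q : ∀ {x : Fin n} (p q : Subset n) → x ∈ p ─ q → x ∉ q
x∈p─q⇒x∉q (inside ∷ p) (outside ∷ q) here      ()
x∈p─q⇒x∉q (s ∷ p)      (t ∷ q)       (there x∈) (there x∈q) = x∈p─q⇒x∉q p q x∈ x∈q

x∈p-y⇒x≢y : ∀ {x y : Fin n} (p : Subset n) → x ∈ p - y → x ≢ y
x∈p-y⇒x≢y {y = y} p x∈ = x∉⁅y⁆⇒x≢y (x∈p─q⇒x∉q p ⁅ y ⁆ x∈)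

∣p∪q∣≤∣p∣+∣q∣ : ∀ (p q : Subset n) → ∣ p ∪ q ∣ ≤ ∣ p ∣ + ∣ q ∣
∣p∪q∣≤∣p∣+∣q∣ []            []            = z≤n
∣p∪q∣≤∣p∣+∣q∣ (outside ∷ p) (outside ∷ q) = ∣p∪q∣≤∣p∣+∣q∣ p q
∣p∪q∣≤∣p∣+∣q∣ (outside ∷ p) (inside  ∷ q) = ≤-trans (s≤s (∣p∪q∣≤∣p∣+∣q∣ p q)) (≤-reflexive (≡.sym (+-suc _ _)))
∣p∪q∣≤∣p∣+∣q∣ (inside  ∷ p) (outside ∷ q) = s≤s (∣p∪q∣≤∣p∣+∣q∣ p q)
∣p∪q∣≤∣p∣+∣q∣ (inside  ∷ p) (inside  ∷ q) = s≤s (≤-trans (∣p∪q∣≤∣p∣+∣q∣ p q) (+-monoʳ-≤ ∣ p ∣ (n≤1+n ∣ q ∣)))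

x∉p⇒∣p∪⁅x⁆∣≡1+∣p∣ : ∀ {x : Fin n} (p : Subset n) → x ∉ p → ∣ p ∪ ⁅ x ⁆ ∣ ≡ suc ∣ p ∣
x∉p⇒∣p∪⁅x⁆∣≡1+∣p∣ {x = x} p x∉p = ≤-antisym
  (≤-trans (∣p∪q∣≤∣p∣+∣q∣ p ⁅ x ⁆) (≤-reflexive (trans (cong (∣ p ∣ +_) (∣⁅x⁆∣≡1 x)) (+-comm ∣ p ∣ 1))))
  (p⊂q⇒∣p∣<∣q∣ (p⊆p∪q ⁅ x ⁆ , x , q⊆p∪q p ⁅ x ⁆ (x∈⁅x⁆ x) , x∉p))

∈∖-there : ∀ {s t} {p q : Subset n} → (∃ λ x → x ∈ q × x ∉ p) → ∃ λ x → x ∈ t ∷ q × x ∉ s ∷ p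
∈∖-there (x , x∈q , x∉p) = suc x , there x∈q , x∉p ∘ drop-there

∣p∣<∣q∣⇒∃∈q∖p : ∀ (p q : Subset n) → ∣ p ∣ < ∣ q ∣ → ∃ λ x → x ∈ q × x ∉ p
∣p∣<∣q∣⇒∃∈q∖p (outside ∷ p) (inside  ∷ q) _  = zero , here , λ ()
∣p∣<∣q∣⇒∃∈q∖p (outside ∷ p) (outside ∷ q) lt = ∈∖-there (∣p∣<∣q∣⇒∃∈q∖p p q lt)
∣p∣<∣q∣⇒∃∈q∖p (inside  ∷ p) (inside  ∷ q) lt = ∈∖-there (∣p∣<∣q∣⇒∃∈q∖p p q (s<s⁻¹ lt))
∣p∣<∣q∣⇒∃∈q∖p (inside  ∷ p) (outside ∷ q) lt = ∈∖-there (∣p∣<∣q∣⇒∃∈q∖p p q (<-trans (n<1+n _) lt))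

nonempty : ∀ {p : Subset n} → 0 < ∣ p ∣ → Nonempty p
nonempty {n} {p} 0<∣p∣ with ∣p∣<∣q∣⇒∃∈q∖p ⊥ p (subst (_< ∣ p ∣) (≡.sym (∣⊥∣≡0 n)) 0<∣p∣)
... | x , x∈p , _ = x , x∈p

⊆∧∣⊇∣≤⇒⊇ : ∀ {p q : Subset n} → p ⊆ q → ∣ q ∣ ≤ ∣ p ∣ → q ⊆ p
⊆∧∣⊇∣≤⇒⊇ {p = p} p⊆q ∣q∣≤∣p∣ {x} x∈q with x ∈? p
... | yes x∈p = x∈p
... | no  x∉p = contradiction (p⊂q⇒∣p∣<∣q∣ (p⊆q , x , x∈q , x∉p)) (≤⇒≯ ∣q∣≤∣p∣)

∈p∪⁅x⁆⁺ : ∀ {p : Subset n} {x y} → y ∈ p ⊎ y ≡ x → y ∈ p ∪ ⁅ x ⁆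
∈p∪⁅x⁆⁺ {p = p} {x} (inj₁ y∈p) = p⊆p∪q ⁅ x ⁆ y∈p
∈p∪⁅x⁆⁺ {p = p} {x} (inj₂ refl) = q⊆p∪q p ⁅ x ⁆ (x∈⁅x⁆ x)

∈p∪⁅x⁆⁻ : ∀ {p : Subset n} {x y} → y ∈ p ∪ ⁅ x ⁆ → y ∈ p ⊎ y ≡ x
∈p∪⁅x⁆⁻ {p = p} {x} y∈ with x∈p∪q⁻ p ⁅ x ⁆ y∈
... | inj₁ y∈p = inj₁ y∈p
... | inj₂ y∈x = inj₂ (x∈⁅y⁆⇒x≡y x y∈x)

x∈p⇒⁅x⁆⊆p : ∀ {p : Subset n} {x} → x ∈ p → ⁅ x ⁆ ⊆ p
x∈p⇒⁅x⁆⊆p {x = x} x∈p y∈⁅x⁆ rewrite x∈⁅y⁆⇒x≡y x y∈⁅x⁆ = x∈p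

∣p∣≡1⇒p⊆⁅x⁆ : ∀ {p : Subset n} {x} → ∣ p ∣ ≡ 1 → x ∈ p → p ⊆ ⁅ x ⁆
∣p∣≡1⇒p⊆⁅x⁆ {x = x} ∣p∣≡1 x∈p = ⊆∧∣⊇∣≤⇒⊇ (x∈p⇒⁅x⁆⊆p x∈p) (≤-reflexive (trans ∣p∣≡1 (≡.sym (∣⁅x⁆∣≡1 x))))

p⊆r∧x∈r⇒p∪⁅x⁆⊆r : ∀ {p r : Subset n} {x} → p ⊆ r → x ∈ r → p ∪ ⁅ x ⁆ ⊆ r
p⊆r∧x∈r⇒p∪⁅x⁆⊆r p⊆r x∈r y∈ with ∈p∪⁅x⁆⁻ y∈
... | inj₁ y∈p  = p⊆r y∈p
... | inj₂ refl = x∈r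

p⊆p-x∪⁅x⁆ : ∀ (p : Subset n) x → p ⊆ (p - x) ∪ ⁅ x ⁆
p⊆p-x∪⁅x⁆ p x {y} y∈p with y ≟ x
... | yes y≡x = ∈p∪⁅x⁆⁺ (inj₂ y≡x)
... | no  y≢x = ∈p∪⁅x⁆⁺ (inj₁ (x∈p∧x≢y⇒x∈p-y y∈p y≢x))

∣p-x∣≤∣p∣∸1 : ∀ {p : Subset n} {x} → x ∈ p → ∣ p - x ∣ ≤ ∣ p ∣ ∸ 1
∣p-x∣≤∣p∣∸1 x∈p = ∸-monoˡ-≤ 1 (x∈p⇒∣p-x∣<∣p∣ x∈p)

grow-by-one : ∀ {p q : Subset n} → p ⊆ q → ∣ p ∣ < ∣ q ∣ →
              ∃ λ t → p ⊆ t × t ⊆ q × ∣ t ∣ ≡ suc ∣ p ∣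
grow-by-one {p = p} {q} p⊆q ∣p∣<∣q∣ with ∣p∣<∣q∣⇒∃∈q∖p p q ∣p∣<∣q∣
... | x , x∈q , x∉p = p ∪ ⁅ x ⁆ , p⊆p∪q ⁅ x ⁆ , p⊆r∧x∈r⇒p∪⁅x⁆⊆r p⊆q x∈q , x∉p⇒∣p∪⁅x⁆∣≡1+∣p∣ p x∉p

∣q∣≡1+∣p∣⇒q⊆p∪⁅x⁆ : ∀ {p q : Subset n} {x} → p ⊆ q → x ∈ q → x ∉ p → ∣ q ∣ ≡ suc ∣ p ∣ → q ⊆ p ∪ ⁅ x ⁆
∣q∣≡1+∣p∣⇒q⊆p∪⁅x⁆ {p = p} p⊆q x∈q x∉p ∣q∣≡1+∣p∣ =
  ⊆∧∣⊇∣≤⇒⊇ (p⊆r∧x∈r⇒p∪⁅x⁆⊆r p⊆q x∈q) (≤-reflexive (trans ∣q∣≡1+∣p∣ (≡.sym (x∉p⇒∣p∪⁅x⁆∣≡1+∣p∣ p x∉p))))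

∃-subset-between : ∀ {p q : Subset n} → p ⊆ q → ∣ p ∣ ≤ k → k ≤ ∣ q ∣ →
                   ∃ λ t → p ⊆ t × t ⊆ q × ∣ t ∣ ≡ k
∃-subset-between {k = k} {p} p⊆q ∣p∣≤k k≤∣q∣
  with grow (k ∸ ∣ p ∣) p⊆q (≤-trans (≤-reflexive (m∸n+n≡m ∣p∣≤k)) k≤∣q∣)
  where
  grow : ∀ d {p q : Subset n} → p ⊆ q → d + ∣ p ∣ ≤ ∣ q ∣ → ∃ λ t → p ⊆ t × t ⊆ q × ∣ t ∣ ≡ d + ∣ p ∣
  grow zero    {p} p⊆q _ = p , id , p⊆q , refl
  grow (suc d) {p} {q} p⊆q 1+d+∣p∣≤∣q∣ with grow-by-one p⊆q (≤-trans (s≤s (m≤n+m ∣ p ∣ d)) 1+d+∣p∣≤∣q∣)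
  ... | p′ , p⊆p′ , p′⊆q , ∣p′∣≡1+∣p∣
    with grow d p′⊆q (subst (λ m → d + m ≤ ∣ q ∣) (≡.sym ∣p′∣≡1+∣p∣) d+1+∣p∣≤∣q∣)
    where d+1+∣p∣≤∣q∣ = ≤-trans (≤-reflexive (+-suc d ∣ p ∣)) 1+d+∣p∣≤∣q∣
  ... | t , p′⊆t , t⊆q , ∣t∣≡ =
    t , p′⊆t ∘ p⊆p′ , t⊆q , trans ∣t∣≡ (trans (cong (d +_) ∣p′∣≡1+∣p∣) (+-suc d ∣ p ∣))
... | t , p⊆t , t⊆q , ∣t∣≡ = t , p⊆t , t⊆q , trans ∣t∣≡ (m∸n+n≡m ∣p∣≤k)

∃-superset-of-size : ∀ {p : Subset n} → ∣ p ∣ ≤ k → k ≤ n → ∃ λ t → p ⊆ t × ∣ t ∣ ≡ k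
∃-superset-of-size {n} ∣p∣≤k k≤n with ∃-subset-between ⊆⊤ ∣p∣≤k (≤-trans k≤n (≤-reflexive (≡.sym (∣⊤∣≡n n))))
... | t , p⊆t , _ , ∣t∣≡k = t , p⊆t , ∣t∣≡k

∃-subset-of-size : k ≤ n → ∃ λ (S : Subset n) → ∣ S ∣ ≡ k
∃-subset-of-size {n = n} k≤n with ∃-superset-of-size {p = ⊥} (≤-trans (≤-reflexive (∣⊥∣≡0 n)) z≤n) k≤n
... | S , _ , ∣S∣≡k = S , ∣S∣≡k

∃-superset-∋ : ∀ {p : Subset n} → ∣ p ∣ < n → ∀ y → ∃ λ q → p ⊆ q × y ∈ q × ∣ q ∣ ≡ suc ∣ p ∣
∃-superset-∋ {n} {p} ∣p∣<n y with y ∈? p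
... | no  y∉p = p ∪ ⁅ y ⁆ , p⊆p∪q _ , ∈p∪⁅x⁆⁺ (inj₂ refl) , x∉p⇒∣p∪⁅x⁆∣≡1+∣p∣ p y∉p
... | yes y∈p with ∣p∣<∣q∣⇒∃∈q∖p p ⊤ (subst (∣ p ∣ <_) (≡.sym (∣⊤∣≡n n)) ∣p∣<n)
...   | x , _ , x∉p = p ∪ ⁅ x ⁆ , p⊆p∪q _ , p⊆p∪q _ y∈p , x∉p⇒∣p∪⁅x⁆∣≡1+∣p∣ p x∉p

∃-min : ∀ {p : Subset n} {x} → x ∈ p → ∃ λ a → a ∈ p × (∀ {y} → y ∈ p → toℕ a ≤ toℕ y)
∃-min {p = inside  ∷ p} _ = zero , here , λ _ → z≤n
∃-min {p = outside ∷ p} (there x∈p) with ∃-min x∈p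
... | a , a∈p , a≤ = suc a , there a∈p , λ { (there y∈p) → s≤s (a≤ y∈p) }

∃-max : ∀ {p : Subset n} {x} → x ∈ p → ∃ λ b → b ∈ p × (∀ {y} → y ∈ p → toℕ y ≤ toℕ b)
∃-max {p = s ∷ p} x∈ with nonempty? p
... | yes (y , y∈p) with ∃-max y∈p
...   | b , b∈p , ≤b = suc b , there b∈p , λ { here → z≤n ; (there y∈p) → s≤s (≤b y∈p) }
∃-max {p = s ∷ p} here        | no p-empty =
  zero , here , λ { here → z≤n ; (there y∈p) → contradiction (_ , y∈p) p-empty }
∃-max {p = s ∷ p} (there x∈p) | no p-empty = contradiction (_ , x∈p) p-empty

∈-tabulate⁺ : ∀ {f : Fin n → Bool} {x} → f x ≡ true → x ∈ tabulate f
∈-tabulate⁺ {f = f} {x} fx = lookup⇒[]= x (tabulate f) (trans (lookup∘tabulate f x) fx)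

∈-tabulate⁻ : ∀ {f : Fin n → Bool} {x} → x ∈ tabulate f → f x ≡ true
∈-tabulate⁻ {f = f} {x} x∈ = trans (≡.sym (lookup∘tabulate f x)) ([]=⇒lookup x∈)

interval : (start length : ℕ) → Subset n
interval {zero}  _         _            = []
interval {suc n} zero      zero         = outside ∷ interval zero zero
interval {suc n} zero      (suc length) = inside  ∷ interval zero length
interval {suc n} (suc start) length     = outside ∷ interval start length

∈-interval⁺ : ∀ lo len {x : Fin n} → lo ≤ toℕ x → toℕ x < lo + len → x ∈ interval lo len
∈-interval⁺ zero     (suc len) {zero}  _       _  = here
∈-interval⁺ zero     (suc len) {suc x} _       x< = there (∈-interval⁺ zero len z≤n (s<s⁻¹ x<))
∈-interval⁺ (suc lo) len       {suc x} lo≤x    x< = there (∈-interval⁺ lo len (s≤s⁻¹ lo≤x) (s<s⁻¹ x<))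

∈-interval⁻ : ∀ lo len {x : Fin n} → x ∈ interval lo len → lo ≤ toℕ x × toℕ x < lo + len
∈-interval⁻ zero     (suc len) here        = z≤n , s≤s z≤n
∈-interval⁻ zero     zero      (there x∈)  = contradiction (proj₂ (∈-interval⁻ zero zero x∈)) λ ()
∈-interval⁻ zero     (suc len) (there x∈)  = z≤n , s≤s (proj₂ (∈-interval⁻ zero len x∈))
∈-interval⁻ (suc lo) len       (there x∈)  with ∈-interval⁻ lo len x∈
... | lo≤x , x< = s≤s lo≤x , s≤s x<

∣interval∣ : ∀ lo len → lo + len ≤ n → ∣ interval {n} lo len ∣ ≡ len
∣interval∣ {zero}  zero     zero      _ = refl
∣interval∣ {suc n} zero     zero      _ = ∣interval∣ {n} zero zero z≤n
∣interval∣ {suc n} zero     (suc len) l = cong suc (∣interval∣ zero len (s≤s⁻¹ l))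
∣interval∣ {suc n} (suc lo) len       l = ∣interval∣ lo len (s≤s⁻¹ l)

_⊆ᴱ_ : (F F′ : Fin n → Fin n → Bool) → Set
F ⊆ᴱ F′ = ∀ {i j} → F i j ≡ true → F′ i j ≡ true

Symmetricᴱ : (Fin n → Fin n → Bool) → Set
Symmetricᴱ F = ∀ i j → F i j ≡ F j i

edgeCount-∑ : ∀ (F : Fin n → Fin n → Bool) →
              edgeCount F ≡ ∑[ i < n ] ∑[ j < n ] 𝟙 ((toℕ i <ᵇ toℕ j) ∧ F i j)
edgeCount-∑ {n} F = trans (listSum-map-allFin {n} _) (sum-cong-≗ {n} λ i → listSum-map-allFin {n} _)

edgeCount-mono : ∀ {F F′ : Fin n → Fin n → Bool} → F ⊆ᴱ F′ → edgeCount F ≤ edgeCount F′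
edgeCount-mono {n} {F} {F′} F⊆F′ = subst₂ _≤_ (≡.sym (edgeCount-∑ F)) (≡.sym (edgeCount-∑ F′))
  (∑-mono-≤ {n} λ i → ∑-mono-≤ {n} λ j → 𝟙-mono (∧-monoʳ (F⊆F′ {i} {j})))

edgeCount-<-ordered : ∀ {F F′ : Fin n → Fin n → Bool} {a b} → F ⊆ᴱ F′ → toℕ a < toℕ b →
                 F′ a b ≡ true → F a b ≡ false → edgeCount F < edgeCount F′
edgeCount-<-ordered {n} {F} {F′} {a} {b} F⊆F′ a<b F′ab Fab =
  subst₂ _<_ (≡.sym (edgeCount-∑ F)) (≡.sym (edgeCount-∑ F′))
    (∑-mono-< a (λ i → ∑-mono-≤ {n} (pointwise i)) (∑-mono-< b (pointwise a) at-ab))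
  where
  pointwise : ∀ i j → 𝟙 ((toℕ i <ᵇ toℕ j) ∧ F i j) ≤ 𝟙 ((toℕ i <ᵇ toℕ j) ∧ F′ i j)
  pointwise i j = 𝟙-mono (∧-monoʳ (F⊆F′ {i} {j}))
  at-ab : 𝟙 ((toℕ a <ᵇ toℕ b) ∧ F a b) < 𝟙 ((toℕ a <ᵇ toℕ b) ∧ F′ a b)
  at-ab rewrite Equivalence.to T-≡ (<⇒<ᵇ a<b) | Fab | F′ab = ≤-refl

edgeCount-< : ∀ {F F′ : Fin n → Fin n → Bool} {u w} → Symmetricᴱ F → Symmetricᴱ F′ → F ⊆ᴱ F′ →
              F′ u w ≡ true → F u w ≡ false → u ≢ w → edgeCount F < edgeCount F′
edgeCount-< {u = u} {w} symF symF′ F⊆F′ F′uw Fuw u≢w with <-cmp (toℕ u) (toℕ w)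
... | tri< u<w _ _ = edgeCount-<-ordered F⊆F′ u<w F′uw Fuw
... | tri≈ _ u≡w _ = contradiction (toℕ-injective u≡w) u≢w
... | tri> _ _ w<u = edgeCount-<-ordered F⊆F′ w<u (trans (symF′ w u) F′uw) (trans (symF w u) Fuw)

_++ʷ_ : ∀ {F : Fin n → Fin n → Bool} {u w v} → Walk F u w → Walk F w v → Walk F u v
here       ++ʷ q = q
step e p   ++ʷ q = step e (p ++ʷ q)

reverseʷ : ∀ {F : Fin n → Fin n → Bool} {u v} → Symmetricᴱ F → Walk F u v → Walk F v u
reverseʷ symF here                     = here
reverseʷ symF (step {u} {w} Fuw p) = reverseʷ symF p ++ʷ step (trans (symF w u) Fuw) here

walk-crossing-edge : ∀ {F : Fin n → Fin n → Bool} {u v} {T : Subset n} → Walk F u v → u ∈ T → v ∉ T →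
              ∃₂ λ x y → F x y ≡ true × x ∈ T × y ∉ T
walk-crossing-edge here u∈T u∉T = contradiction u∈T u∉T
walk-crossing-edge {T = T} (step {u} {w} Fuw p) u∈T v∉T with w ∈? T
... | yes w∈T = walk-crossing-edge p w∈T v∉T
... | no  w∉T = u , w , Fuw , u∈T , w∉T

walk-first-edge : ∀ {F : Fin n → Fin n → Bool} {u v} → Walk F u v → u ≢ v → ∃ λ w → F u w ≡ true
walk-first-edge here              u≢u = contradiction refl u≢u
walk-first-edge (step {w = w} e _) _  = w , e

edge-target∈verts : ∀ {G : Graph n} (H : Subgraph G) {u w} → edges H u w ≡ true → w ∈ verts H
edge-target∈verts H {u} {w} Euw = e-in-W H w u (trans (e-sym H w u) Euw)

module _ {G : Graph n} (H : Subgraph G) (conn : ConnectedSub H) where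

  private
    W = verts H
    E = edges H

  edgesWithin : Subset n → Fin n → Fin n → Bool
  edgesWithin T i j = E i j ∧ does (i ∈? T) ∧ does (j ∈? T)

  private
    edgesWithin-sym : ∀ T → Symmetricᴱ (edgesWithin T)
    edgesWithin-sym T i j = cong₂ _∧_ (e-sym H i j) (∧-comm (does (i ∈? T)) (does (j ∈? T)))

    edgesWithin⁺ : ∀ {T i j} → E i j ≡ true → i ∈ T → j ∈ T → edgesWithin T i j ≡ true
    edgesWithin⁺ {T} {i} {j} Eij i∈T j∈T rewrite Eij | dec-true (i ∈? T) i∈T | dec-true (j ∈? T) j∈T = refl

    edgesWithin⁻ : ∀ {T i j} → edgesWithin T i j ≡ true → E i j ≡ true × i ∈ T × j ∈ T
    edgesWithin⁻ {T} {i} {j} within with ∧-true⁻ within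
    ... | Eij , ij∈T with ∧-true⁻ ij∈T
    ... | i∈T , j∈T = Eij , does⁻ (i ∈? T) i∈T , does⁻ (j ∈? T) j∈T

    edgesWithin-mono : ∀ {T T′} → T ⊆ T′ → edgesWithin T ⊆ᴱ edgesWithin T′
    edgesWithin-mono T⊆T′ within with edgesWithin⁻ within
    ... | Eij , i∈T , j∈T = edgesWithin⁺ Eij (T⊆T′ i∈T) (T⊆T′ j∈T)

    edgesWithin⊆E : ∀ {T} → edgesWithin T ⊆ᴱ E
    edgesWithin⊆E = proj₁ ∘ edgesWithin⁻

    add-crossing-edge : ∀ {T x y} → T ⊆ W → E x y ≡ true → x ∈ T → y ∉ T →
      T ∪ ⁅ y ⁆ ⊆ W × ∣ T ∪ ⁅ y ⁆ ∣ ≡ suc ∣ T ∣ ×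
      edgeCount (edgesWithin T) < edgeCount (edgesWithin (T ∪ ⁅ y ⁆))
    add-crossing-edge {T} {x} {y} T⊆W Exy x∈T y∉T =
      p⊆r∧x∈r⇒p∪⁅x⁆⊆r T⊆W (edge-target∈verts H Exy) ,
      x∉p⇒∣p∪⁅x⁆∣≡1+∣p∣ T y∉T ,
      edgeCount-< (edgesWithin-sym T) (edgesWithin-sym (T ∪ ⁅ y ⁆)) (edgesWithin-mono (p⊆p∪q ⁅ y ⁆))
        (edgesWithin⁺ Exy (p⊆p∪q ⁅ y ⁆ x∈T) (q⊆p∪q T ⁅ y ⁆ (x∈⁅x⁆ y)))
        not-within
        (λ x≡y → y∉T (subst (_∈ T) x≡y x∈T))
      where
      not-within : edgesWithin T x y ≡ false
      not-within rewrite Exy | dec-true (x ∈? T) x∈T | dec-false (y ∈? T) y∉T = refl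

    grow : ∀ d {T} → T ⊆ W → Nonempty T → ∣ W ∣ ≤ d + ∣ T ∣ →
           ∣ T ∣ ≤ suc (edgeCount (edgesWithin T)) → ∣ W ∣ ≤ suc (edgeCount E)
    grow d {T} T⊆W (r , r∈T) ∣W∣≤d+∣T∣ ∣T∣≤ with ∣ W ∣ ≤? ∣ T ∣ | d
    ... | yes ∣W∣≤∣T∣ | _     = ≤-trans ∣W∣≤∣T∣ (≤-trans ∣T∣≤ (s≤s (edgeCount-mono {n} (edgesWithin⊆E {T}))))
    ... | no  ∣W∣≰∣T∣ | zero  = contradiction ∣W∣≤d+∣T∣ ∣W∣≰∣T∣
    ... | no  ∣W∣≰∣T∣ | suc d with ∣p∣<∣q∣⇒∃∈q∖p T W (≰⇒> ∣W∣≰∣T∣)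
    ... | v , v∈W , v∉T with walk-crossing-edge (conn r v (T⊆W r∈T) v∈W) r∈T v∉T
    ... | x , y , Exy , x∈T , y∉T with add-crossing-edge T⊆W Exy x∈T y∉T
    ... | T′⊆W , ∣T′∣≡ , more-edges = grow d T′⊆W (r , p⊆p∪q ⁅ y ⁆ r∈T)
          (≤-trans ∣W∣≤d+∣T∣ (≤-reflexive (trans (≡.sym (+-suc d ∣ T ∣)) (cong (d +_) (≡.sym ∣T′∣≡)))))
          (subst (_≤ suc (edgeCount (edgesWithin (T ∪ ⁅ y ⁆)))) (≡.sym ∣T′∣≡) (s≤s (≤-trans ∣T∣≤ more-edges)))

  ∣verts∣≤1+edgeCount : ∣ W ∣ ≤ suc (edgeCount E)
  ∣verts∣≤1+edgeCount with nonempty? W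
  ... | no  W-empty = ≤-trans (≮⇒≥ (W-empty ∘ nonempty)) z≤n
  ... | yes (r , r∈W) = grow ∣ W ∣ (x∈p⇒⁅x⁆⊆p r∈W) (r , x∈⁅x⁆ r)
          (≤-trans (m≤m+n ∣ W ∣ 1) (≤-reflexive (cong (∣ W ∣ +_) (≡.sym (∣⁅x⁆∣≡1 r)))))
          (≤-trans (≤-reflexive (∣⁅x⁆∣≡1 r)) (s≤s z≤n))

HasSteinerSubgraph⇒∣S∣≤1+m : ∀ {G : Graph n} {S m} → HasSteinerSubgraph G S m → ∣ S ∣ ≤ suc m
HasSteinerSubgraph⇒∣S∣≤1+m (H , conn , S⊆W , refl) = ≤-trans (p⊆q⇒∣p∣≤∣q∣ S⊆W) (∣verts∣≤1+edgeCount H conn)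

SteinerDist≤ : Graph n → Subset n → ℕ → Set
SteinerDist≤ G S r = ∃ λ m → m ≤ r × HasSteinerSubgraph G S m

SteinerDist≥ : Graph n → Subset n → ℕ → Set
SteinerDist≥ G S r = ∀ m → HasSteinerSubgraph G S m → r ≤ m

SteinerDist≤-weaken : ∀ {G : Graph n} {S r r′} → r ≤ r′ → SteinerDist≤ G S r → SteinerDist≤ G S r′
SteinerDist≤-weaken r≤r′ (m , m≤r , has) = m , ≤-trans m≤r r≤r′ , has

module _ {G : Graph n} where

  SteinerDist-intro : ∀ {S d} → SteinerDist≤ G S d → SteinerDist≥ G S d → SteinerDist G S d
  SteinerDist-intro (m , m≤d , has) d≤ with ≤-antisym m≤d (d≤ m has)
  ... | refl = has , d≤

  SteinerDist≥-k∸1 : ∀ S → ∣ S ∣ ≡ k → SteinerDist≥ G S (k ∸ 1)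
  SteinerDist≥-k∸1 S refl m has = ∸-monoˡ-≤ 1 (HasSteinerSubgraph⇒∣S∣≤1+m has)

  SteinerEcc-intro : ∀ {S′ T e} → S′ ⊆ T → ∣ T ∣ ≡ k → SteinerDist G T e →
                     (∀ T′ → S′ ⊆ T′ → ∣ T′ ∣ ≡ k → SteinerDist≤ G T′ e) → SteinerEcc G k S′ e
  SteinerEcc-intro {T = T} S′⊆T ∣T∣≡k dist upper =
    (T , S′⊆T , ∣T∣≡k , dist) ,
    λ { T′ d S′⊆T′ ∣T′∣≡k (_ , d≤) → let (m , m≤e , has) = upper T′ S′⊆T′ ∣T′∣≡k in ≤-trans (d≤ m has) m≤e }

  SteinerEcc-≥ : ∀ {S′ r e} → (∀ T → ∣ T ∣ ≡ k → SteinerDist≥ G T r) → SteinerEcc G k S′ e → r ≤ e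
  SteinerEcc-≥ {e = e} lower ((T , _ , ∣T∣≡k , has , _) , _) = lower T ∣T∣≡k e has

  SteinerRad-central : ∀ {k′ r S′} → k′ ≤ k → k ≤ n → (∀ T → ∣ T ∣ ≡ k → SteinerDist≥ G T r) →
                       ∣ S′ ∣ ≡ k′ → (∀ T → S′ ⊆ T → ∣ T ∣ ≡ k → SteinerDist≤ G T r) →
                       SteinerRad G k k′ r
  SteinerRad-central {S′ = S′} k′≤k k≤n lower ∣S′∣≡k′ upper
    with ∃-superset-of-size {p = S′} (≤-trans (≤-reflexive ∣S′∣≡k′) k′≤k) k≤n
  ... | T , S′⊆T , ∣T∣≡k =
    (S′ , ∣S′∣≡k′ ,
     SteinerEcc-intro S′⊆T ∣T∣≡k (SteinerDist-intro (upper T S′⊆T ∣T∣≡k) (lower T ∣T∣≡k)) upper) ,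
    λ _ _ _ → SteinerEcc-≥ lower

  SteinerRad-spread : ∀ {k′ r} → k′ ≤ n → (∀ T → ∣ T ∣ ≡ k → SteinerDist≤ G T r) →
                      (∀ S′ → ∣ S′ ∣ ≡ k′ → ∃ λ T → S′ ⊆ T × ∣ T ∣ ≡ k × SteinerDist G T r) →
                      SteinerRad G k k′ r
  SteinerRad-spread {k′ = k′} {r} k′≤n upper witness
    with ∃-subset-of-size k′≤n
  ... | S′ , ∣S′∣≡k′ with witness S′ ∣S′∣≡k′
  ... | T , S′⊆T , ∣T∣≡k , dist =
    (S′ , ∣S′∣≡k′ , SteinerEcc-intro S′⊆T ∣T∣≡k dist (λ T′ _ → upper T′)) ,
    λ { S″ e ∣S″∣≡k′ (_ , ≤e) → let (T″ , S″⊆T″ , ∣T″∣≡k , dist″) = witness S″ ∣S″∣≡k′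
                                  in ≤e T″ r S″⊆T″ ∣T″∣≡k dist″ }

child? : (parent : Fin n → Fin n) (X : Subset n) → ∀ i j → Dec (parent j ≡ i × j ∈ X)
child? parent X i j = (parent j ≟ i) ×-dec (j ∈? X)

treeEdges : (parent : Fin n → Fin n) → Subset n → Fin n → Fin n → Bool
treeEdges parent X i j = does (child? parent X i j ⊎-dec child? parent X j i)

-- Every edge is counted once, at its endpoint x ∈ X whose parent is the other endpoint.
edgeCount-treeEdges : ∀ (parent : Fin n → Fin n) (X : Subset n) → edgeCount (treeEdges parent X) ≤ ∣ X ∣
edgeCount-treeEdges {n} parent X = begin
  edgeCount (treeEdges parent X)
    ≡⟨ edgeCount-∑ (treeEdges parent X) ⟩
  ∑[ i < n ] ∑[ j < n ] 𝟙 ((i <ᵇ′ j) ∧ (c i j ∨ c j i))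
    ≤⟨ ∑-mono-≤ {n} (λ i → ∑-mono-≤ {n} λ j → 𝟙-∧-∨ (i <ᵇ′ j) (c i j) (c j i)) ⟩
  ∑[ i < n ] ∑[ j < n ] (𝟙 (c i j ∧ (i <ᵇ′ j)) + 𝟙 (c j i ∧ (i <ᵇ′ j)))
    ≡⟨ sum-cong-≗ {n} (λ i → ∑-distrib-+ (λ j → 𝟙 (c i j ∧ (i <ᵇ′ j))) _) ⟩
  ∑[ i < n ] (∑[ j < n ] 𝟙 (c i j ∧ (i <ᵇ′ j)) + ∑[ j < n ] 𝟙 (c j i ∧ (i <ᵇ′ j)))
    ≡⟨ ∑-distrib-+ (λ i → ∑[ j < n ] 𝟙 (c i j ∧ (i <ᵇ′ j))) _ ⟩
  ∑[ i < n ] ∑[ j < n ] 𝟙 (c i j ∧ (i <ᵇ′ j)) + ∑[ i < n ] ∑[ j < n ] 𝟙 (c j i ∧ (i <ᵇ′ j))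
    ≡⟨ cong₂ _+_ (∑-comm (λ i j → 𝟙 (c i j ∧ (i <ᵇ′ j)))) refl ⟩
  ∑[ j < n ] ∑[ i < n ] 𝟙 (c i j ∧ (i <ᵇ′ j)) + ∑[ i < n ] ∑[ j < n ] 𝟙 (c j i ∧ (i <ᵇ′ j))
    ≡⟨ cong₂ _+_ (sum-cong-≗ {n} λ j → ∑-𝟙-≟ (parent j) (X? j) (_<ᵇ′ j))
                 (sum-cong-≗ {n} λ i → ∑-𝟙-≟ (parent i) (X? i) (i <ᵇ′_)) ⟩
  ∑[ x < n ] 𝟙 (X? x ∧ (parent x <ᵇ′ x)) + ∑[ x < n ] 𝟙 (X? x ∧ (x <ᵇ′ parent x))
    ≡⟨ ∑-distrib-+ (λ x → 𝟙 (X? x ∧ (parent x <ᵇ′ x))) _ ⟨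
  ∑[ x < n ] (𝟙 (X? x ∧ (parent x <ᵇ′ x)) + 𝟙 (X? x ∧ (x <ᵇ′ parent x)))
    ≤⟨ ∑-mono-≤ {n} (λ x → 𝟙-<ᵇ-asym (X? x) (toℕ (parent x)) (toℕ x)) ⟩
  ∑[ x < n ] 𝟙 (X? x)
    ≡⟨ ∣p∣≡∑ X ⟨
  ∣ X ∣ ∎
  where
  open ≤-Reasoning
  c : Fin n → Fin n → Bool
  c i j = does (child? parent X i j)
  X? : Fin n → Bool
  X? x = does (x ∈? X)
  _<ᵇ′_ : Fin n → Fin n → Bool
  i <ᵇ′ j = toℕ i <ᵇ toℕ j

-- A tree on X ∪ ⁅ root ⁆ given by parent pointers; the decreasing rank rules out cycles.
record ParentTree (G : Graph n) (root : Fin n) (X : Subset n) : Set where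
  field
    parent      : Fin n → Fin n
    rank        : Fin n → ℕ
    parent-adj  : ∀ {x} → x ∈ X → adj G x (parent x) ≡ true
    parent-∈    : ∀ {x} → x ∈ X → parent x ∈ X ⊎ parent x ≡ root
    parent-rank : ∀ {x} → x ∈ X → rank (parent x) < rank x

module _ {G : Graph n} {root X} (tree : ParentTree G root X) where
  open ParentTree tree

  private
    E = treeEdges parent X

    E-sym : Symmetricᴱ E
    E-sym i j = ∨-comm (does (child? parent X i j)) (does (child? parent X j i))

    E⁻ : ∀ {i j} → E i j ≡ true → (parent j ≡ i × j ∈ X) ⊎ (parent i ≡ j × i ∈ X)
    E⁻ {i} {j} = does⁻ (child? parent X i j ⊎-dec child? parent X j i)

    E⊆G : ∀ i j → E i j ≡ true → adj G i j ≡ true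
    E⊆G i j Eij with E⁻ Eij
    ... | inj₁ (refl , j∈X) = trans (Graph.sym G (parent j) j) (parent-adj j∈X)
    ... | inj₂ (refl , i∈X) = parent-adj i∈X

    E⊆W : ∀ i j → E i j ≡ true → i ∈ X ∪ ⁅ root ⁆
    E⊆W i j Eij with E⁻ Eij
    ... | inj₁ (refl , j∈X) = ∈p∪⁅x⁆⁺ (parent-∈ j∈X)
    ... | inj₂ (_    , i∈X) = ∈p∪⁅x⁆⁺ (inj₁ i∈X)

    walk-to-root : ∀ b {x} → rank x < b → x ∈ X ⊎ x ≡ root → Walk E x root
    walk-to-root _       _          (inj₂ refl) = here
    walk-to-root (suc b) rank-x<1+b (inj₁ x∈X)  =
      step (dec-true (child? parent X _ _ ⊎-dec child? parent X _ _) (inj₂ (refl , x∈X)))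
           (walk-to-root b (≤-trans (parent-rank x∈X) (s≤s⁻¹ rank-x<1+b)) (parent-∈ x∈X))

  treeSubgraph : Subgraph G
  treeSubgraph = record
    { verts = X ∪ ⁅ root ⁆ ; edges = E ; e-sym = E-sym ; e-in-G = E⊆G ; e-in-W = E⊆W }

  treeSubgraph-connected : ConnectedSub treeSubgraph
  treeSubgraph-connected u v u∈ v∈ = to-root u∈ ++ʷ reverseʷ E-sym (to-root v∈)
    where
    to-root : ∀ {x} → x ∈ X ∪ ⁅ root ⁆ → Walk E x root
    to-root {x} x∈ = walk-to-root (suc (rank x)) ≤-refl (∈p∪⁅x⁆⁻ x∈)

  ParentTree⇒SteinerDist≤ : ∀ {S} → S ⊆ X ∪ ⁅ root ⁆ → SteinerDist≤ G S ∣ X ∣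
  ParentTree⇒SteinerDist≤ S⊆ =
    edgeCount E , edgeCount-treeEdges parent X , treeSubgraph , treeSubgraph-connected , S⊆ , refl

star : ∀ {G : Graph n} {c X} → (∀ {x} → x ∈ X → adj G x c ≡ true) → ParentTree G c X
star {n} {G} {c} {X} adj-c = record
  { parent      = λ _ → c
  ; rank        = rank
  ; parent-adj  = adj-c
  ; parent-∈    = λ _ → inj₂ refl
  ; parent-rank = rank-c<rank-x
  }
  where
  rank : Fin n → ℕ
  rank x = if does (x ≟ c) then 0 else 1
  ≢c : ∀ {x} → x ∈ X → x ≢ c
  ≢c {x} x∈X refl = contradiction (trans (≡.sym (irrefl G x)) (adj-c x∈X)) λ ()
  rank-c<rank-x : ∀ {x} → x ∈ X → rank c < rank x
  rank-c<rank-x {x} x∈X rewrite dec-true (c ≟ c) refl | dec-false (x ≟ c) (≢c x∈X) = s≤s z≤n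

spanningTree⇒SteinerDist≤ : ∀ {G : Graph n} {S c} → c ∈ S → ParentTree G c (S - c) → SteinerDist≤ G S (∣ S ∣ ∸ 1)
spanningTree⇒SteinerDist≤ {S = S} {c} c∈S tree =
  SteinerDist≤-weaken (∣p-x∣≤∣p∣∸1 {p = S} c∈S) (ParentTree⇒SteinerDist≤ tree (p⊆p-x∪⁅x⁆ S c))

complete-adj : ∀ {u v : Fin n} → u ≢ v → adj (complete n) u v ≡ true
complete-adj {u = u} {v} u≢v with toℕ u ≡ᵇ toℕ v in eq
... | true  = contradiction (toℕ-injective (≡ᵇ⇒≡ (toℕ u) (toℕ v) (Equivalence.from T-≡ eq))) u≢v
... | false = refl

complete-SteinerDist≤ : ∀ {S : Subset n} → 0 < ∣ S ∣ → SteinerDist≤ (complete n) S (∣ S ∣ ∸ 1)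
complete-SteinerDist≤ {n} {S} 0<∣S∣ with nonempty {p = S} 0<∣S∣
... | c , c∈S = spanningTree⇒SteinerDist≤ c∈S (star λ x∈ → complete-adj (x∈p-y⇒x≢y S x∈))

complete-SteinerRad : ∀ {k′} → 0 < k → k ≤ n → k′ ≤ k → SteinerRad (complete n) k k′ (k ∸ 1)
complete-SteinerRad {k} {n} 0<k k≤n k′≤k with ∃-subset-of-size {n = n} (≤-trans k′≤k k≤n)
... | S′ , ∣S′∣≡k′ =
  SteinerRad-central {S′ = S′} k′≤k k≤n SteinerDist≥-k∸1 ∣S′∣≡k′ λ { T _ refl → complete-SteinerDist≤ 0<k }

path-adj⁻ : ∀ {u v : Fin n} → adj (path n) u v ≡ true → suc (toℕ u) ≡ toℕ v ⊎ suc (toℕ v) ≡ toℕ u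
path-adj⁻ {u = u} {v} uv with ∨-true⁻ {suc (toℕ u) ≡ᵇ toℕ v} uv
... | inj₁ eq = inj₁ (≡ᵇ⇒≡ _ _ (Equivalence.from T-≡ eq))
... | inj₂ eq = inj₂ (≡ᵇ⇒≡ _ _ (Equivalence.from T-≡ eq))

path-adj⁺ : ∀ {u v : Fin n} → suc (toℕ v) ≡ toℕ u → adj (path n) u v ≡ true
path-adj⁺ {u = u} {v} 1+v≡u
  rewrite Equivalence.to T-≡ (≡⇒≡ᵇ (suc (toℕ v)) (toℕ u) 1+v≡u) = ∨-zeroʳ (suc (toℕ u) ≡ᵇ toℕ v)

suc-toℕ-pred : ∀ (x : Fin n) → 0 < toℕ x → suc (toℕ (pred x)) ≡ toℕ x
suc-toℕ-pred (suc x) _ = cong suc (toℕ-inject₁ x)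

module _ {H : Subgraph (path n)} where

  walk-covers : ∀ {u v c} → Walk (edges H) u v → u ∈ verts H →
                toℕ u ≤ toℕ c → toℕ c ≤ toℕ v → c ∈ verts H
  walk-covers here u∈W u≤c c≤u = subst (_∈ verts H) (toℕ-injective (≤-antisym u≤c c≤u)) u∈W
  walk-covers {u} {c = c} (step {w = w} Euw p) u∈W u≤c c≤v with m≤n⇒m<n∨m≡n u≤c
  ... | inj₂ u≡c = subst (_∈ verts H) (toℕ-injective u≡c) u∈W
  ... | inj₁ u<c with path-adj⁻ (e-in-G H u w Euw)
  ...   | inj₁ 1+u≡w = walk-covers p (edge-target∈verts H Euw) (subst (_≤ toℕ c) 1+u≡w u<c) c≤v
  ...   | inj₂ 1+w≡u =
    walk-covers p (edge-target∈verts H Euw) (≤-trans (≤-trans (n≤1+n _) (≤-reflexive 1+w≡u)) u≤c) c≤v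

path-SteinerDist≥ : ∀ {S : Subset n} {u v} → u ∈ S → v ∈ S → toℕ u ≤ toℕ v →
                    SteinerDist≥ (path n) S (toℕ v ∸ toℕ u)
path-SteinerDist≥ {n} {u = u} {v} u∈S v∈S u≤v _ (H , conn , S⊆W , refl) =
  s≤s⁻¹ (≤-trans (≤-reflexive (≡.sym ∣[u,v]∣)) (≤-trans (p⊆q⇒∣p∣≤∣q∣ [u,v]⊆W) (∣verts∣≤1+edgeCount H conn)))
  where
  length = suc (toℕ v ∸ toℕ u)
  u+length≡1+v : toℕ u + length ≡ suc (toℕ v)
  u+length≡1+v = trans (+-suc (toℕ u) _) (cong suc (m+[n∸m]≡n u≤v))
  ∣[u,v]∣ : ∣ interval {n} (toℕ u) length ∣ ≡ length
  ∣[u,v]∣ = ∣interval∣ (toℕ u) length (≤-trans (≤-reflexive u+length≡1+v) (toℕ<n v))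
  [u,v]⊆W : interval (toℕ u) length ⊆ verts H
  [u,v]⊆W {x} x∈ with ∈-interval⁻ (toℕ u) length x∈
  ... | u≤x , x< = walk-covers {H = H} (conn u v (S⊆W u∈S) (S⊆W v∈S)) (S⊆W u∈S) u≤x
                     (s≤s⁻¹ (subst (toℕ x <_) u+length≡1+v x<))

path-SteinerDist≤ : ∀ {S : Subset n} lo hi → lo ≤ hi → hi < n →
                    (∀ {x} → x ∈ S → lo ≤ toℕ x × toℕ x ≤ hi) → SteinerDist≤ (path n) S (hi ∸ lo)
path-SteinerDist≤ {n} {S} lo hi lo≤hi hi<n S⊆[lo,hi] =
  subst (SteinerDist≤ (path n) S) ∣X∣≡
    (ParentTree⇒SteinerDist≤ tree λ x∈S → ∈p∪⁅x⁆⁺ (split (S⊆[lo,hi] x∈S)))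
  where
  root : Fin n
  root = fromℕ< (≤-<-trans lo≤hi hi<n)
  X : Subset n
  X = interval (suc lo) (hi ∸ lo)
  end≡ : suc lo + (hi ∸ lo) ≡ suc hi
  end≡ = cong suc (m+[n∸m]≡n lo≤hi)
  ∣X∣≡ : ∣ X ∣ ≡ hi ∸ lo
  ∣X∣≡ = ∣interval∣ (suc lo) (hi ∸ lo) (≤-trans (≤-reflexive end≡) hi<n)
  split : ∀ {y} → lo ≤ toℕ y × toℕ y ≤ hi → y ∈ X ⊎ y ≡ root
  split {y} (lo≤y , y≤hi) with m≤n⇒m<n∨m≡n lo≤y
  ... | inj₁ lo<y = inj₁ (∈-interval⁺ (suc lo) (hi ∸ lo) lo<y (subst (toℕ y <_) (≡.sym end≡) (s≤s y≤hi)))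
  ... | inj₂ lo≡y = inj₂ (toℕ-injective (trans (≡.sym lo≡y) (≡.sym (toℕ-fromℕ< _))))
  pred-bounds : ∀ {x} → x ∈ X → lo ≤ toℕ (pred x) × toℕ (pred x) ≤ hi × suc (toℕ (pred x)) ≡ toℕ x
  pred-bounds {x} x∈X with ∈-interval⁻ (suc lo) (hi ∸ lo) x∈X
  ... | lo<x , x<end = s≤s⁻¹ (subst (suc lo ≤_) (≡.sym x≡) lo<x) ,
                       s≤s⁻¹ (≤-trans (≤-reflexive x≡) (≤-trans (s≤s⁻¹ (subst (toℕ x <_) end≡ x<end)) (n≤1+n hi))) ,
                       x≡
    where x≡ = suc-toℕ-pred x (≤-trans (s≤s z≤n) lo<x)
  tree : ParentTree (path n) root X
  tree = record
    { parent      = pred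
    ; rank        = toℕ
    ; parent-adj  = λ x∈X → path-adj⁺ (proj₂ (proj₂ (pred-bounds x∈X)))
    ; parent-∈    = λ x∈X → split (proj₁ (pred-bounds x∈X) , proj₁ (proj₂ (pred-bounds x∈X)))
    ; parent-rank = λ x∈X → ≤-reflexive (proj₂ (proj₂ (pred-bounds x∈X)))
    }

path-SteinerDist : ∀ {S : Subset n} {a b} → a ∈ S → b ∈ S → (∀ {x} → x ∈ S → toℕ a ≤ toℕ x × toℕ x ≤ toℕ b) →
                   SteinerDist (path n) S (toℕ b ∸ toℕ a)
path-SteinerDist {a = a} {b} a∈S b∈S S⊆[a,b] = SteinerDist-intro
  (path-SteinerDist≤ (toℕ a) (toℕ b) a≤b (toℕ<n b) S⊆[a,b])
  (path-SteinerDist≥ a∈S b∈S a≤b)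
  where a≤b = proj₁ (S⊆[a,b] b∈S)

path-SteinerDist-exists : ∀ {S : Subset n} {x} → x ∈ S → ∃ λ d → SteinerDist (path n) S d
path-SteinerDist-exists x∈S with ∃-min x∈S | ∃-max x∈S
... | a , a∈S , a≤ | b , b∈S , ≤b = _ , path-SteinerDist a∈S b∈S λ y∈S → a≤ y∈S , ≤b y∈S

path-SteinerEcc-≥ : ∀ {S′ T : Subset n} {e u v} → SteinerEcc (path n) k S′ e → S′ ⊆ T → ∣ T ∣ ≡ k →
                    u ∈ T → v ∈ T → toℕ u ≤ toℕ v → toℕ v ∸ toℕ u ≤ e
path-SteinerEcc-≥ (_ , ≤e) S′⊆T ∣T∣≡k u∈T v∈T u≤v with path-SteinerDist-exists u∈T
... | d , dist@(has , _) = ≤-trans (path-SteinerDist≥ u∈T v∈T u≤v _ has) (≤e _ d S′⊆T ∣T∣≡k dist)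

path-SteinerRad-k′≡k : 0 < k → k ≤ n → SteinerRad (path n) k k (k ∸ 1)
path-SteinerRad-k′≡k {suc k₁} {n} _ k≤n = SteinerRad-central ≤-refl k≤n SteinerDist≥-k∸1 ∣S′∣≡k upper
  where
  S′ : Subset n
  S′ = interval 0 (suc k₁)
  ∣S′∣≡k : ∣ S′ ∣ ≡ suc k₁
  ∣S′∣≡k = ∣interval∣ 0 (suc k₁) k≤n
  upper : ∀ T → S′ ⊆ T → ∣ T ∣ ≡ suc k₁ → SteinerDist≤ (path n) T k₁
  upper T S′⊆T ∣T∣≡k =
    path-SteinerDist≤ 0 k₁ z≤n k≤n λ x∈T → z≤n , s≤s⁻¹ (proj₂ (∈-interval⁻ 0 (suc k₁) (T⊆S′ x∈T)))
    where T⊆S′ = ⊆∧∣⊇∣≤⇒⊇ S′⊆T (≤-reflexive (trans ∣T∣≡k (≡.sym ∣S′∣≡k)))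

path-SteinerRad-k′+2≤k : ∀ {k′} → 2 + k′ ≤ k → k ≤ n → SteinerRad (path n) k k′ (n ∸ 1)
path-SteinerRad-k′+2≤k {n = zero}  (s≤s (s≤s _)) ()
path-SteinerRad-k′+2≤k {k} {suc N} {k′} k′+2≤k k≤n =
  SteinerRad-spread (≤-trans (≤-trans (m≤n+m k′ 2) k′+2≤k) k≤n) upper witness
  where
  first last : Fin (suc N)
  first = zero
  last  = fromℕ N
  upper : ∀ T → ∣ T ∣ ≡ k → SteinerDist≤ (path (suc N)) T N
  upper T _ = path-SteinerDist≤ 0 N z≤n ≤-refl λ {x} _ → z≤n , s≤s⁻¹ (toℕ<n x)
  witness : ∀ S′ → ∣ S′ ∣ ≡ k′ → ∃ λ T → S′ ⊆ T × ∣ T ∣ ≡ k × SteinerDist (path (suc N)) T N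
  witness S′ ∣S′∣≡k′ with ∃-superset-of-size {p = S′ ∪ ⁅ first ⁆ ∪ ⁅ last ⁆} ∣ends∣≤k k≤n
    where
    ∣ends∣≤k : ∣ S′ ∪ ⁅ first ⁆ ∪ ⁅ last ⁆ ∣ ≤ k
    ∣ends∣≤k = begin
      ∣ S′ ∪ ⁅ first ⁆ ∪ ⁅ last ⁆ ∣            ≤⟨ ∣p∪q∣≤∣p∣+∣q∣ S′ _ ⟩
      ∣ S′ ∣ + ∣ ⁅ first ⁆ ∪ ⁅ last ⁆ ∣         ≤⟨ +-monoʳ-≤ ∣ S′ ∣ (∣p∪q∣≤∣p∣+∣q∣ ⁅ first ⁆ ⁅ last ⁆) ⟩
      ∣ S′ ∣ + (∣ ⁅ first ⁆ ∣ + ∣ ⁅ last ⁆ ∣)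
        ≡⟨ cong₂ (λ a b → ∣ S′ ∣ + (a + b)) (∣⁅x⁆∣≡1 first) (∣⁅x⁆∣≡1 last) ⟩
      ∣ S′ ∣ + 2                               ≡⟨ trans (+-comm ∣ S′ ∣ 2) (cong (2 +_) ∣S′∣≡k′) ⟩
      2 + k′                                   ≤⟨ k′+2≤k ⟩
      k                                        ∎
      where open ≤-Reasoning
  ... | T , ends⊆T , ∣T∣≡k = T , ends⊆T ∘ p⊆p∪q _ , ∣T∣≡k ,
    subst (SteinerDist (path (suc N)) T) (toℕ-fromℕ N)
      (path-SteinerDist (ends⊆T (q⊆p∪q S′ _ (p⊆p∪q _ (x∈⁅x⁆ first))))
                        (ends⊆T (q⊆p∪q S′ _ (q⊆p∪q ⁅ first ⁆ _ (x∈⁅x⁆ last))))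
                        λ {x} _ → z≤n , subst (toℕ x ≤_) (≡.sym (toℕ-fromℕ N)) (s≤s⁻¹ (toℕ<n x)))

⌈m+[n+n]/2⌉≡⌈m/2⌉+n : ∀ m n → ⌈ m + (n + n) /2⌉ ≡ ⌈ m /2⌉ + n
⌈m+[n+n]/2⌉≡⌈m/2⌉+n m zero    = trans (cong ⌈_/2⌉ (+-identityʳ m)) (≡.sym (+-identityʳ _))
⌈m+[n+n]/2⌉≡⌈m/2⌉+n m (suc n) = begin
  ⌈ m + (suc n + suc n) /2⌉   ≡⟨ cong ⌈_/2⌉ (trans (+-suc m (n + suc n)) (cong (λ t → suc (m + t)) (+-suc n n))) ⟩
  ⌈ suc (m + suc (n + n)) /2⌉ ≡⟨ cong (λ t → ⌈ suc t /2⌉) (+-suc m (n + n)) ⟩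
  suc ⌈ m + (n + n) /2⌉       ≡⟨ cong suc (⌈m+[n+n]/2⌉≡⌈m/2⌉+n m n) ⟩
  suc (⌈ m /2⌉ + n)           ≡⟨ +-suc ⌈ m /2⌉ n ⟨
  ⌈ m /2⌉ + suc n             ∎
  where open ≡-Reasoning

⌈n/2⌉≤m : ∀ {n m} → n ≤ m + m → ⌈ n /2⌉ ≤ m
⌈n/2⌉≤m {m = m} n≤m+m = ≤-trans (⌈n/2⌉-mono n≤m+m) (≤-reflexive (⌈m+[n+n]/2⌉≡⌈m/2⌉+n 0 m))

⌊m/2⌋<m : ∀ {m} → 0 < m → ⌊ m /2⌋ < m
⌊m/2⌋<m {suc m} _ = ⌊n/2⌋<n m

-- Adding 0 (or a free vertex, if 0 ∈ S′) to S′ gives e ≥ max S′, adding N gives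
-- e ≥ N − min S′, and max S′ − min S′ ≥ j since S′ has j + 1 elements.
path-SteinerEcc-k′+1-≥ : ∀ {N j} {S′ : Subset (suc N)} {e} → j < N → ∣ S′ ∣ ≡ suc j →
                         SteinerEcc (path (suc N)) (2 + j) S′ e → N + j ≤ e + e
path-SteinerEcc-k′+1-≥ {N} {j} {S′} {e} j<N ∣S′∣≡1+j ecc
  with nonempty {p = S′} (subst (0 <_) (≡.sym ∣S′∣≡1+j) (s≤s z≤n))
... | x , x∈S′ with ∃-min x∈S′ | ∃-max x∈S′
... | a , a∈S′ , a≤ | b , b∈S′ , ≤b = begin
  N + j                 ≤⟨ +-monoʳ-≤ N j≤b∸a ⟩
  N + (toℕ b ∸ toℕ a)   ≡⟨ +-∸-assoc N a≤b ⟨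
  N + toℕ b ∸ toℕ a     ≡⟨ cong (_∸ toℕ a) (+-comm N (toℕ b)) ⟩
  toℕ b + N ∸ toℕ a     ≡⟨ +-∸-assoc (toℕ b) a≤N ⟩
  toℕ b + (N ∸ toℕ a)   ≤⟨ +-mono-≤ b≤e N∸a≤e ⟩
  e + e                 ∎
  where
  open ≤-Reasoning
  last : Fin (suc N)
  last = fromℕ N
  a≤b : toℕ a ≤ toℕ b
  a≤b = a≤ b∈S′
  a≤N : toℕ a ≤ N
  a≤N = s≤s⁻¹ (toℕ<n a)
  ecc-≥ : ∀ y {u v} → u ∈ S′ ⊎ u ≡ y → v ∈ S′ ⊎ v ≡ y → toℕ u ≤ toℕ v → toℕ v ∸ toℕ u ≤ e
  ecc-≥ y u∈ v∈ u≤v with ∃-superset-∋ (subst (_< suc N) (≡.sym ∣S′∣≡1+j) (s≤s j<N)) y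
  ... | T , S′⊆T , y∈T , ∣T∣≡ =
    path-SteinerEcc-≥ ecc S′⊆T (trans ∣T∣≡ (cong suc ∣S′∣≡1+j)) (in-T u∈) (in-T v∈) u≤v
    where
    in-T : ∀ {w} → w ∈ S′ ⊎ w ≡ y → w ∈ T
    in-T (inj₁ w∈S′) = S′⊆T w∈S′
    in-T (inj₂ refl) = y∈T
  b≤e : toℕ b ≤ e
  b≤e = ecc-≥ zero (inj₂ refl) (inj₁ b∈S′) z≤n
  N∸a≤e : N ∸ toℕ a ≤ e
  N∸a≤e = subst (λ t → t ∸ toℕ a ≤ e) (toℕ-fromℕ N)
    (ecc-≥ last (inj₁ a∈S′) (inj₂ refl) (subst (toℕ a ≤_) (≡.sym (toℕ-fromℕ N)) a≤N))
  j≤b∸a : j ≤ toℕ b ∸ toℕ a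
  j≤b∸a with path-SteinerDist≤ {S = S′} (toℕ a) (toℕ b) a≤b (toℕ<n b) (λ y∈S′ → a≤ y∈S′ , ≤b y∈S′)
  ... | m , m≤b∸a , has =
    s≤s⁻¹ (≤-trans (≤-reflexive (≡.sym ∣S′∣≡1+j)) (≤-trans (HasSteinerSubgraph⇒∣S∣≤1+m has) (s≤s m≤b∸a)))

path-centre-SteinerEcc : ∀ {N j h} → h + j < N → h + j ≤ N ∸ h →
                         SteinerEcc (path (suc N)) (2 + j) (interval h (suc j)) (N ∸ h)
path-centre-SteinerEcc {N} {j} {h} h+j<N h+j≤N∸h =
  SteinerEcc-intro (p⊆p∪q ⁅ last ⁆) ∣S′∪last∣≡2+j dist upper
  where
  S′ : Subset (suc N)
  S′ = interval h (suc j)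
  h≤N : h ≤ N
  h≤N = ≤-trans (m≤m+n h j) (<⇒≤ h+j<N)
  ∣S′∣≡1+j : ∣ S′ ∣ ≡ suc j
  ∣S′∣≡1+j = ∣interval∣ h (suc j) (≤-trans (≤-reflexive (+-suc h j)) (s≤s (<⇒≤ h+j<N)))
  S′-bounds : ∀ {x} → x ∈ S′ → h ≤ toℕ x × toℕ x ≤ h + j
  S′-bounds {x} x∈S′ with ∈-interval⁻ h (suc j) x∈S′
  ... | h≤x , x<h+1+j = h≤x , s≤s⁻¹ (subst (toℕ x <_) (+-suc h j) x<h+1+j)
  S′∪⁅x⁆-bounds : ∀ {x y lo hi} → lo ≤ h → h + j ≤ hi → lo ≤ toℕ x × toℕ x ≤ hi →
                  y ∈ S′ ∪ ⁅ x ⁆ → lo ≤ toℕ y × toℕ y ≤ hi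
  S′∪⁅x⁆-bounds lo≤h h+j≤hi x-bounds y∈ with ∈p∪⁅x⁆⁻ y∈
  ... | inj₁ y∈S′ = ≤-trans lo≤h (proj₁ (S′-bounds y∈S′)) , ≤-trans (proj₂ (S′-bounds y∈S′)) h+j≤hi
  ... | inj₂ refl = x-bounds
  last centre : Fin (suc N)
  last   = fromℕ N
  centre = fromℕ< (s≤s h≤N)
  last∉S′ : last ∉ S′
  last∉S′ last∈S′ = <⇒≱ h+j<N (subst (_≤ h + j) (toℕ-fromℕ N) (proj₂ (S′-bounds last∈S′)))
  ∣S′∪last∣≡2+j : ∣ S′ ∪ ⁅ last ⁆ ∣ ≡ 2 + j
  ∣S′∪last∣≡2+j = trans (x∉p⇒∣p∪⁅x⁆∣≡1+∣p∣ S′ last∉S′) (cong suc ∣S′∣≡1+j)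
  toℕ-centre : toℕ centre ≡ h
  toℕ-centre = toℕ-fromℕ< (s≤s h≤N)
  centre∈S′ : centre ∈ S′
  centre∈S′ = ∈-interval⁺ h (suc j) (≤-reflexive (≡.sym toℕ-centre))
                (subst (_< h + suc j) (≡.sym toℕ-centre) (m<m+n h (s≤s z≤n)))
  dist : SteinerDist (path (suc N)) (S′ ∪ ⁅ last ⁆) (N ∸ h)
  dist = subst₂ (λ b a → SteinerDist (path (suc N)) (S′ ∪ ⁅ last ⁆) (b ∸ a)) (toℕ-fromℕ N) toℕ-centre
    (path-SteinerDist (p⊆p∪q ⁅ last ⁆ centre∈S′) (∈p∪⁅x⁆⁺ (inj₂ refl))
      (S′∪⁅x⁆-bounds (≤-reflexive toℕ-centre) (subst (h + j ≤_) (≡.sym (toℕ-fromℕ N)) (<⇒≤ h+j<N))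
                     (subst₂ _≤_ (≡.sym toℕ-centre) (≡.sym (toℕ-fromℕ N)) h≤N , ≤-refl)))
  upper : ∀ T → S′ ⊆ T → ∣ T ∣ ≡ 2 + j → SteinerDist≤ (path (suc N)) T (N ∸ h)
  upper T S′⊆T ∣T∣≡2+j with ∣p∣<∣q∣⇒∃∈q∖p S′ T (≤-reflexive (trans (cong suc ∣S′∣≡1+j) (≡.sym ∣T∣≡2+j)))
  ... | x , x∈T , x∉S′ =
    with-extra x (∣q∣≡1+∣p∣⇒q⊆p∪⁅x⁆ S′⊆T x∈T x∉S′ (trans ∣T∣≡2+j (cong suc (≡.sym ∣S′∣≡1+j))))
    where
    with-extra : ∀ x → T ⊆ S′ ∪ ⁅ x ⁆ → SteinerDist≤ (path (suc N)) T (N ∸ h)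
    with-extra x T⊆ with toℕ x <? h
    ... | yes x<h = SteinerDist≤-weaken h+j≤N∸h (path-SteinerDist≤ 0 (h + j) z≤n (s≤s (<⇒≤ h+j<N))
                      λ y∈T → S′∪⁅x⁆-bounds z≤n ≤-refl (z≤n , ≤-trans (<⇒≤ x<h) (m≤m+n h j)) (T⊆ y∈T))
    ... | no  x≮h = path-SteinerDist≤ h N h≤N ≤-refl
                      λ y∈T → S′∪⁅x⁆-bounds ≤-refl (<⇒≤ h+j<N) (≮⇒≥ x≮h , s≤s⁻¹ (toℕ<n x)) (T⊆ y∈T)

-- The centre {h, …, h + j} with h = ⌊(N − j)/2⌋: one more vertex on the left costs at most
-- h + j, on the right at most N − h = ⌈(N + j)/2⌉.
path-SteinerRad-2+j : ∀ {N j} → j < N → SteinerRad (path (suc N)) (2 + j) (1 + j) ⌈ N + j /2⌉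
path-SteinerRad-2+j {N} {j} j<N =
  (interval h (suc j) , ∣S′∣≡1+j ,
   subst (SteinerEcc (path (suc N)) (2 + j) (interval h (suc j))) (≡.sym R≡N∸h)
         (path-centre-SteinerEcc h+j<N h+j≤N∸h)) ,
  λ S′ e ∣S′∣≡1+j ecc → ⌈n/2⌉≤m (path-SteinerEcc-k′+1-≥ j<N ∣S′∣≡1+j ecc)
  where
  m = N ∸ j
  h = ⌊ m /2⌋
  N≡m+j : N ≡ m + j
  N≡m+j = ≡.sym (m∸n+n≡m (<⇒≤ j<N))
  0<m : 0 < m
  0<m = subst (_< m) (n∸n≡0 j) (∸-monoˡ-< j<N ≤-refl)
  h+j<N : h + j < N
  h+j<N = subst (h + j <_) (≡.sym N≡m+j) (+-monoˡ-< j (⌊m/2⌋<m 0<m))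
  R≡⌈m/2⌉+j : ⌈ N + j /2⌉ ≡ ⌈ m /2⌉ + j
  R≡⌈m/2⌉+j = begin
    ⌈ N + j /2⌉        ≡⟨ cong (λ t → ⌈ t + j /2⌉) N≡m+j ⟩
    ⌈ m + j + j /2⌉    ≡⟨ cong ⌈_/2⌉ (+-assoc m j j) ⟩
    ⌈ m + (j + j) /2⌉  ≡⟨ ⌈m+[n+n]/2⌉≡⌈m/2⌉+n m j ⟩
    ⌈ m /2⌉ + j        ∎
    where open ≡-Reasoning
  N∸h≡⌈m/2⌉+j : N ∸ h ≡ ⌈ m /2⌉ + j
  N∸h≡⌈m/2⌉+j = begin
    N ∸ h                  ≡⟨ cong (_∸ h) N≡m+j ⟩
    m + j ∸ h              ≡⟨ cong (λ t → t + j ∸ h) (⌊n/2⌋+⌈n/2⌉≡n m) ⟨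
    h + ⌈ m /2⌉ + j ∸ h    ≡⟨ cong (_∸ h) (+-assoc h ⌈ m /2⌉ j) ⟩
    h + (⌈ m /2⌉ + j) ∸ h  ≡⟨ m+n∸m≡n h (⌈ m /2⌉ + j) ⟩
    ⌈ m /2⌉ + j            ∎
    where open ≡-Reasoning
  R≡N∸h : ⌈ N + j /2⌉ ≡ N ∸ h
  R≡N∸h = trans R≡⌈m/2⌉+j (≡.sym N∸h≡⌈m/2⌉+j)
  h+j≤N∸h : h + j ≤ N ∸ h
  h+j≤N∸h = ≤-trans (+-monoˡ-≤ j (⌊n/2⌋≤⌈n/2⌉ m)) (≤-reflexive (≡.sym N∸h≡⌈m/2⌉+j))
  ∣S′∣≡1+j : ∣ interval {suc N} h (suc j) ∣ ≡ suc j
  ∣S′∣≡1+j = ∣interval∣ h (suc j) (≤-trans (≤-reflexive (+-suc h j)) (s≤s (<⇒≤ h+j<N)))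

path-SteinerRad-k≡k′+1 : ∀ {k′} → 0 < k′ → suc k′ ≤ n → SteinerRad (path n) (suc k′) k′ ⌈ n + k′ ∸ 2 /2⌉
path-SteinerRad-k≡k′+1 {suc N} {suc j} _ (s≤s j<N) =
  subst (SteinerRad (path (suc N)) (2 + j) (1 + j)) (cong (λ t → ⌈ t ∸ 1 /2⌉) (≡.sym (+-suc N j)))
        (path-SteinerRad-2+j j<N)

module Multipartite {r} (part : Fin n → Fin r) where

  G : Graph n
  G = multipartite part

  members : Fin r → Subset n
  members p = tabulate (λ i → does (part i ≟ p))

  ∈-members⁺ : ∀ {x p} → part x ≡ p → x ∈ members p
  ∈-members⁺ {x} {p} part-x≡p = ∈-tabulate⁺ (dec-true (part x ≟ p) part-x≡p)

  ∈-members⁻ : ∀ {x p} → x ∈ members p → part x ≡ p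
  ∈-members⁻ {x} {p} x∈ = does⁻ (part x ≟ p) (∈-tabulate⁻ x∈)

  ∃-member : ∀ {p} → 0 < partSize part p → ∃ λ v → part v ≡ p
  ∃-member 0<size with nonempty 0<size
  ... | v , v∈ = v , ∈-members⁻ v∈

  adj⁺ : ∀ {u v} → part u ≢ part v → adj G u v ≡ true
  adj⁺ {u} {v} u≁v = cong not (dec-false (part u ≟ part v) u≁v)

  adj⁻ : ∀ {u v} → adj G u v ≡ true → part u ≢ part v
  adj⁻ {u} {v} uv u∼v = contradiction (trans (≡.sym (cong not (dec-true (part u ≟ part v) u∼v))) uv) λ ()

  doubleStar : ∀ {S s₀ s₁} → s₁ ∈ S → part s₀ ≢ part s₁ → ParentTree G s₀ (S - s₀)
  doubleStar {S} {s₀} {s₁} s₁∈S s₀≁s₁ = record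
    { parent = parent ; rank = rank ; parent-adj = parent-adj ; parent-∈ = parent-∈ ; parent-rank = parent-rank }
    where
    parent : Fin n → Fin n
    parent x = if does (part x ≟ part s₀) then s₁ else s₀
    rank : Fin n → ℕ
    rank x = if does (x ≟ s₀) then 0 else if does (part x ≟ part s₀) then 2 else 1
    s₁≢s₀ : s₁ ≢ s₀
    s₁≢s₀ refl = s₀≁s₁ refl
    parent-adj : ∀ {x} → x ∈ S - s₀ → adj G x (parent x) ≡ true
    parent-adj {x} _ with part x ≟ part s₀
    ... | yes x∼s₀ = adj⁺ λ x∼s₁ → s₀≁s₁ (trans (≡.sym x∼s₀) x∼s₁)
    ... | no  x≁s₀ = adj⁺ x≁s₀
    parent-∈ : ∀ {x} → x ∈ S - s₀ → parent x ∈ S - s₀ ⊎ parent x ≡ s₀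
    parent-∈ {x} _ with part x ≟ part s₀
    ... | yes _ = inj₁ (x∈p∧x≢y⇒x∈p-y s₁∈S s₁≢s₀)
    ... | no  _ = inj₂ refl
    parent-rank : ∀ {x} → x ∈ S - s₀ → rank (parent x) < rank x
    parent-rank {x} x∈ rewrite dec-false (x ≟ s₀) (x∈p-y⇒x≢y S x∈) with part x ≟ part s₀
    ... | yes _ rewrite dec-false (s₁ ≟ s₀) s₁≢s₀ | dec-false (part s₁ ≟ part s₀) (s₀≁s₁ ∘ ≡.sym) = ≤-refl
    ... | no  _ rewrite dec-true (s₀ ≟ s₀) refl = ≤-refl

  doubleStar-SteinerDist≤ : ∀ {S s₀ s₁} → s₀ ∈ S → s₁ ∈ S → part s₀ ≢ part s₁ → SteinerDist≤ G S (∣ S ∣ ∸ 1)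
  doubleStar-SteinerDist≤ s₀∈S s₁∈S s₀≁s₁ = spanningTree⇒SteinerDist≤ s₀∈S (doubleStar s₁∈S s₀≁s₁)

  outerStar-SteinerDist≤ : ∀ {S P w} → (∀ {x} → x ∈ S → part x ≡ P) → part w ≢ P → SteinerDist≤ G S ∣ S ∣
  outerStar-SteinerDist≤ {S} {w = w} S⊆P w∉P =
    ParentTree⇒SteinerDist≤ (star {X = S} λ x∈S → adj⁺ λ x∼w → w∉P (trans (≡.sym x∼w) (S⊆P x∈S))) (p⊆p∪q ⁅ w ⁆)

  -- The first edge of a walk in H between two vertices of S leaves their part, hence S.
  onePart-SteinerDist≥ : ∀ {S P} → (∀ {x} → x ∈ S → part x ≡ P) → 2 ≤ ∣ S ∣ → SteinerDist≥ G S ∣ S ∣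
  onePart-SteinerDist≥ {S} S⊆P 2≤∣S∣ _ (H , conn , S⊆W , refl) with nonempty {p = S} (≤-trans (s≤s z≤n) 2≤∣S∣)
  ... | s₁ , s₁∈S with ∣p∣<∣q∣⇒∃∈q∖p ⁅ s₁ ⁆ S (subst (_< ∣ S ∣) (≡.sym (∣⁅x⁆∣≡1 s₁)) 2≤∣S∣)
  ... | s₂ , s₂∈S , s₂∉s₁ with walk-first-edge (conn s₁ s₂ (S⊆W s₁∈S) (S⊆W s₂∈S)) (s₂∉s₁ ∘ ∈-s₁)
    where ∈-s₁ : s₁ ≡ s₂ → s₂ ∈ ⁅ s₁ ⁆
          ∈-s₁ refl = x∈⁅x⁆ s₁
  ... | w , s₁w = s≤s⁻¹ (≤-trans (≤-reflexive (≡.sym (x∉p⇒∣p∪⁅x⁆∣≡1+∣p∣ S w∉S)))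
                          (≤-trans (p⊆q⇒∣p∣≤∣q∣ (p⊆r∧x∈r⇒p∪⁅x⁆⊆r S⊆W (edge-target∈verts H s₁w)))
                                   (∣verts∣≤1+edgeCount H conn)))
    where
    w∉S : w ∉ S
    w∉S w∈S = adj⁻ (e-in-G H s₁ w s₁w) (trans (S⊆P s₁∈S) (≡.sym (S⊆P w∈S)))

  onePart-SteinerDist : ∀ {S P w} → (∀ {x} → x ∈ S → part x ≡ P) → 2 ≤ ∣ S ∣ → part w ≢ P →
                        SteinerDist G S ∣ S ∣
  onePart-SteinerDist S⊆P 2≤∣S∣ w∉P =
    SteinerDist-intro (outerStar-SteinerDist≤ S⊆P w∉P) (onePart-SteinerDist≥ S⊆P 2≤∣S∣)

  SteinerDist≤-∣S∣ : ∀ {S} → (∀ p → ∃ λ w → part w ≢ p) → 0 < ∣ S ∣ → SteinerDist≤ G S ∣ S ∣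
  SteinerDist≤-∣S∣ {S} elsewhere 0<∣S∣ with nonempty {p = S} 0<∣S∣
  ... | s₀ , s₀∈S with any? (λ x → (x ∈? S) ×-dec ¬? (part s₀ ≟ part x))
  ...   | yes (s₁ , s₁∈S , s₀≁s₁) = SteinerDist≤-weaken (m∸n≤m ∣ S ∣ 1) (doubleStar-SteinerDist≤ s₀∈S s₁∈S s₀≁s₁)
  ...   | no  ∄s₁ = outerStar-SteinerDist≤ S⊆part-s₀ (proj₂ (elsewhere (part s₀)))
    where
    S⊆part-s₀ : ∀ {x} → x ∈ S → part x ≡ part s₀
    S⊆part-s₀ {x} x∈S with part x ≟ part s₀
    ... | yes x∼s₀ = x∼s₀
    ... | no  x≁s₀ = contradiction (x , x∈S , x≁s₀ ∘ ≡.sym) ∄s₁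

  SteinerRad-k≤partSizes : (∀ p → ∃ λ w → part w ≢ p) → 2 ≤ k → k ≤ n → (∀ p → k ≤ partSize part p) →
                           SteinerRad G k 1 k
  SteinerRad-k≤partSizes {k} elsewhere 2≤k k≤n k≤sizes =
    SteinerRad-spread (≤-trans (s≤s z≤n) (≤-trans 2≤k k≤n)) upper witness
    where
    upper : ∀ T → ∣ T ∣ ≡ k → SteinerDist≤ G T k
    upper T ∣T∣≡k =
      subst (SteinerDist≤ G T) ∣T∣≡k (SteinerDist≤-∣S∣ elsewhere (subst (0 <_) (≡.sym ∣T∣≡k) (≤-trans (s≤s z≤n) 2≤k)))
    witness : ∀ S′ → ∣ S′ ∣ ≡ 1 → ∃ λ T → S′ ⊆ T × ∣ T ∣ ≡ k × SteinerDist G T k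
    witness S′ ∣S′∣≡1 with nonempty {p = S′} (≤-reflexive (≡.sym ∣S′∣≡1))
    ... | v , v∈S′
      with ∃-subset-between {p = S′} S′⊆part-v (≤-trans (≤-reflexive ∣S′∣≡1) (≤-trans (s≤s z≤n) 2≤k)) (k≤sizes (part v))
      where
      S′⊆part-v : S′ ⊆ members (part v)
      S′⊆part-v y∈S′ = ∈-members⁺ (cong part (x∈⁅y⁆⇒x≡y v (∣p∣≡1⇒p⊆⁅x⁆ ∣S′∣≡1 v∈S′ y∈S′)))
    ... | T , S′⊆T , T⊆part-v , ∣T∣≡k = T , S′⊆T , ∣T∣≡k ,
      subst (SteinerDist G T) ∣T∣≡k (onePart-SteinerDist (∈-members⁻ ∘ T⊆part-v) (subst (2 ≤_) (≡.sym ∣T∣≡k) 2≤k)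
                                                          (proj₂ (elsewhere (part v))))

  SteinerRad-smallPart : ∀ {P} → k ≤ n → 0 < partSize part P → partSize part P < k → SteinerRad G k 1 (k ∸ 1)
  SteinerRad-smallPart {k} {P} k≤n 0<size size<k with ∃-member 0<size
  ... | v , v∼P = SteinerRad-central (≤-trans 0<size (<⇒≤ size<k)) k≤n SteinerDist≥-k∸1 (∣⁅x⁆∣≡1 v) upper
    where
    upper : ∀ T → ⁅ v ⁆ ⊆ T → ∣ T ∣ ≡ k → SteinerDist≤ G T (k ∸ 1)
    upper T v⊆T ∣T∣≡k with ∣p∣<∣q∣⇒∃∈q∖p (members P) T (subst (partSize part P <_) (≡.sym ∣T∣≡k) size<k)
    ... | x , x∈T , x∉P = subst (λ t → SteinerDist≤ G T (t ∸ 1)) ∣T∣≡k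
      (doubleStar-SteinerDist≤ (v⊆T (x∈⁅x⁆ v)) x∈T λ v∼x → x∉P (∈-members⁺ (trans (≡.sym v∼x) v∼P)))

  SteinerRad-2≤k′ : ∀ {k′ u w} → part u ≢ part w → 2 ≤ k′ → k′ ≤ k → k ≤ n → SteinerRad G k k′ (k ∸ 1)
  SteinerRad-2≤k′ {k} {k′} {u} {w} u≁w 2≤k′ k′≤k k≤n
    with ∃-superset-of-size {p = ⁅ u ⁆ ∪ ⁅ w ⁆} ∣uw∣≤k′ (≤-trans k′≤k k≤n)
    where
    ∣uw∣≤k′ : ∣ ⁅ u ⁆ ∪ ⁅ w ⁆ ∣ ≤ k′
    ∣uw∣≤k′ = ≤-trans (∣p∪q∣≤∣p∣+∣q∣ ⁅ u ⁆ ⁅ w ⁆)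
                      (subst₂ (λ a b → a + b ≤ k′) (≡.sym (∣⁅x⁆∣≡1 u)) (≡.sym (∣⁅x⁆∣≡1 w)) 2≤k′)
  ... | S′ , uw⊆S′ , ∣S′∣≡k′ = SteinerRad-central k′≤k k≤n SteinerDist≥-k∸1 ∣S′∣≡k′ upper
    where
    upper : ∀ T → S′ ⊆ T → ∣ T ∣ ≡ k → SteinerDist≤ G T (k ∸ 1)
    upper T S′⊆T ∣T∣≡k = subst (λ t → SteinerDist≤ G T (t ∸ 1)) ∣T∣≡k
      (doubleStar-SteinerDist≤ (S′⊆T (uw⊆S′ (p⊆p∪q ⁅ w ⁆ (x∈⁅x⁆ u))))
                               (S′⊆T (uw⊆S′ (q⊆p∪q ⁅ u ⁆ ⁅ w ⁆ (x∈⁅x⁆ w)))) u≁w)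

module _ {r} (part : Fin n → Fin (2 + r)) (sizes : ∀ p → 1 ≤ partSize part p) where
  open Multipartite part

  ∃-vertex-elsewhere : ∀ p → ∃ λ w → part w ≢ p
  ∃-vertex-elsewhere zero    with ∃-member (sizes (suc zero))
  ... | w , w∼1 = w , λ w∼0 → contradiction (trans (≡.sym w∼1) w∼0) λ ()
  ∃-vertex-elsewhere (suc p) with ∃-member (sizes zero)
  ... | w , w∼0 = w , λ w∼p → contradiction (trans (≡.sym w∼0) w∼p) λ ()

  ∃-vertices-in-distinct-parts : ∃₂ λ u w → part u ≢ part w
  ∃-vertices-in-distinct-parts with ∃-member (sizes zero) | ∃-vertex-elsewhere zero
  ... | u , u∼0 | w , w≁0 = u , w , λ u∼w → w≁0 (trans (≡.sym u∼w) u∼0)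

proposition2p9 : (∀ (n k k' : ℕ) → 2 ≤ k → k ≤ n → 1 ≤ k' → k' ≤ k →
       SteinerRad (complete n) k k' (k ∸ 1))
    × (∀ (n k k' : ℕ) → 2 ≤ k → k ≤ n → 1 ≤ k' → k' ≤ k →
         (k ≡ k' → SteinerRad (path n) k k' (k ∸ 1))
         × (k ≡ suc k' → SteinerRad (path n) k k' ⌈ n + k' ∸ 2 /2⌉)
         × (2 + k' ≤ k → SteinerRad (path n) k k' (n ∸ 1)))
    × (∀ (n k k' r : ℕ) (part : Fin n → Fin (2 + r)) →
         2 ≤ k → k ≤ n → 1 ≤ k' → k' ≤ k →
         (∀ p → 1 ≤ partSize part p) →
         (∀ p q → p ≤ᶠ q → partSize part p ≤ partSize part q) →
         (k' ≡ 1 → k ≤ partSize part zero →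
            SteinerRad (multipartite part) k k' k)
         × (k' ≡ 1 → partSize part zero < k →
            SteinerRad (multipartite part) k k' (k ∸ 1))
         × (2 ≤ k' → SteinerRad (multipartite part) k k' (k ∸ 1)))
proposition2p9 =
  (λ n k k′ 2≤k k≤n _ k′≤k → complete-SteinerRad (≤-trans (s≤s z≤n) 2≤k) k≤n k′≤k) ,
  (λ n k k′ 2≤k k≤n 1≤k′ k′≤k →
     (λ { refl → path-SteinerRad-k′≡k (≤-trans (s≤s z≤n) 2≤k) k≤n }) ,
     (λ { refl → path-SteinerRad-k≡k′+1 1≤k′ k≤n }) ,
     (λ 2+k′≤k → path-SteinerRad-k′+2≤k 2+k′≤k k≤n)) ,
  (λ n k k′ r part 2≤k k≤n _ k′≤k sizes sorted → let open Multipartite part in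
     (λ { refl k≤size₀ → SteinerRad-k≤partSizes (∃-vertex-elsewhere part sizes) 2≤k k≤n
                            λ p → ≤-trans k≤size₀ (sorted zero p z≤n) }) ,
     (λ { refl size₀<k → SteinerRad-smallPart k≤n (sizes zero) size₀<k }) ,
     (λ 2≤k′ → let (u , w , u≁w) = ∃-vertices-in-distinct-parts part sizes
               in SteinerRad-2≤k′ u≁w 2≤k′ k′≤k k≤n))
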